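{- Let $G$ be a subgraph of an $n$-node graph with node identifiers in $[n]$, in which every node $v$ has a palette of $p(v)$ colors from $[n^2]$ and degree $d(v)$, and let $\ell$ be sufficiently large with $\ell^{0.1}$ an integer, such that for all nodes $v$: $\ell<p(v)$, $d(v)\le\ell+\ell^{0.7}$, and $d(v)<p(v)$. Let $h_1$ be uniform from a $c$-wise independent family $[n]\to[\ell^{0.1}]$ and $h_2$ uniform from a $c$-wise independent family $[n^2]\to[\ell^{0.1}-1]$, chosen independently, for a sufficiently large constant $c$. Then every node is bad with probability at most $2\ell^{ -3}$.
   Context: $d'(v)$ is the number of neighbors $u$ of $v$ in $G$ with $h_1(u)=h_1(v)$; for $h_1(v)\in\{1,\dots,\ell^{0.1}-1\}$, $p'(v)$ is the number of colors $\gamma$ of $v$'s palette with $h_2(\gamma)=h_1(v)$. A node $v$ with $h_1(v)\in\{1,\dots,\ell^{0.1}-1\}$ is good if $|d'(v)-d(v)\ell^{ -0.1}|\le\ell^{0.6}$ and $p'(v)\ge p(v)\ell^{ -0.1}+\ell^{0.7}$; a node with $h_1(v)=\ell^{0.1}$ is good if $|d'(v)-d(v)\ell^{ -0.1}|\le\ell^{0.6}$; otherwise it is bad. A family $\mathcal H$ of functions $[N]\to[L]$ is $c$-wise independent if for all distinct $x_1,\dots,x_c$, the values $h(x_1),\dots,h(x_c)$ are independent and uniform in $[L]$ for uniform $h\in\mathcal H$. -}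

module Defs where

open import Data.Nat using (ℕ; zero; suc; _+_; _*_; _∸_; _^_; _≤_; _<_; _≤ᵇ_)
open import Data.Fin using (Fin; zero; suc; toℕ)
import Data.Fin as F
open import Data.Bool using (Bool; true; false; _∧_; not; if_then_else_; T)
open import Data.Product using (_×_)
open import Relation.Nullary using (does; ¬_)
open import Relation.Binary.PropositionalEquality using (_≡_)
open import Function.Definitions using (Injective)

count : ∀ {k} → (Fin k → Bool) → ℕ
count {zero}  P = 0
count {suc k} P = (if P zero then 1 else 0) + count (λ i → P (suc i))

sumF : ∀ {k} → (Fin k → ℕ) → ℕ
sumF {zero}  f = 0
sumF {suc k} f = f zero + sumF (λ i → f (suc i))

allF : ∀ {k} → (Fin k → Bool) → Bool
allF {zero}  P = true
allF {suc k} P = P zero ∧ allF (λ i → P (suc i))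

_=ᶠ_ : ∀ {k} → Fin k → Fin k → Bool
x =ᶠ y = does (x F.≟ y)

-- A (finite, indexed) family of functions [N] → [L], given as H : Fin K → (Fin N → Fin L),
-- the uniform distribution being the uniform choice of the index in Fin K.
-- c-wise independence: for all distinct x_1..x_c and all y_1..y_c,
--   Pr[h(x_j) = y_j for all j] = L^{-c},  i.e.  #{i | H i (x_j) = y_j ∀ j} * L^c = K.
CWiseIndependent : (c K N L : ℕ) → (Fin K → Fin N → Fin L) → Set
CWiseIndependent c K N L H =
  (xs : Fin c → Fin N) → Injective _≡_ _≡_ xs → (ys : Fin c → Fin L) →
  count (λ i → allF (λ j → H i (xs j) =ᶠ ys j)) * L ^ c ≡ K

IsFamily : (K N L : ℕ) → (Fin K → Fin N → Fin L) → Set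
IsFamily K N L H = (0 < K) × (∀ i j → (∀ x → H i x ≡ H j x) → i ≡ j)

IsGraph : (n : ℕ) → (Fin n → Bool) → (Fin n → Fin n → Bool) → Set
IsGraph n inG adj =
  (∀ u v → adj u v ≡ adj v u) × (∀ v → adj v v ≡ false) ×
  (∀ u v → T (adj u v) → T (inG u))

deg : ∀ {n} → (Fin n → Fin n → Bool) → Fin n → ℕ
deg adj v = count (λ u → adj v u)

palSize : ∀ {n} → (Fin n → Fin (n ^ 2) → Bool) → Fin n → ℕ
palSize pal v = count (pal v)

-- Here ℓ = m^10, so ℓ^0.1 = m.  h1 : [n] → [m] with values encoded 0..m-1
-- (h1 value k+1 in the paper ↔ toℕ = k), h2 : [n^2] → [m-1] likewise.
-- d'(v)
deg' : ∀ {n m} → (Fin n → Fin n → Bool) → (Fin n → Fin m) → Fin n → ℕ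
deg' adj h1 v = count (λ u → adj v u ∧ (h1 u =ᶠ h1 v))

pal' : ∀ {n m} → (Fin n → Fin (n ^ 2) → Bool) → (Fin n → Fin m) → (Fin (n ^ 2) → Fin (m ∸ 1)) → Fin n → ℕ
pal' pal h1 h2 v = count (λ γ → pal v γ ∧ does (toℕ (h2 γ) Data.Nat.≟ toℕ (h1 v)))
  where import Data.Nat

-- |d'(v) - d(v) ℓ^{-0.1}| ≤ ℓ^{0.6}, multiplied by m = ℓ^{0.1}:  |m d' - d| ≤ m^7
degOK : (m d d' : ℕ) → Bool
degOK m d d' = (d ≤ᵇ m * d' + m ^ 7) ∧ (m * d' ≤ᵇ d + m ^ 7)

-- p'(v) ≥ p(v) ℓ^{-0.1} + ℓ^{0.7}, multiplied by m:  m p' ≥ p + m^8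
palOK : (m p p' : ℕ) → Bool
palOK m p p' = p + m ^ 8 ≤ᵇ m * p'

-- good(v); h1 v encoded 0..m-1: toℕ (h1 v) < m-1 is the case h1(v) ∈ {1..ℓ^0.1 - 1},
-- toℕ (h1 v) = m-1 is the case h1(v) = ℓ^0.1.
good : ∀ {n m} → (Fin n → Fin n → Bool) → (Fin n → Fin (n ^ 2) → Bool) →
       (Fin n → Fin m) → (Fin (n ^ 2) → Fin (m ∸ 1)) → Fin n → Bool
good {n} {m} adj pal h1 h2 v =
  if suc (toℕ (h1 v)) ≤ᵇ m ∸ 1
  then degOK m (deg adj v) (deg' adj h1 v) ∧ palOK m (palSize pal v) (pal' pal h1 h2 v)
  else degOK m (deg adj v) (deg' adj h1 v)

countBad : ∀ {n m K₁ K₂} → (Fin n → Fin n → Bool) → (Fin n → Fin (n ^ 2) → Bool) →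
           (Fin K₁ → Fin n → Fin m) → (Fin K₂ → Fin (n ^ 2) → Fin (m ∸ 1)) → Fin n → ℕ
countBad adj pal H₁ H₂ v =
  sumF (λ i → count (λ j → not (good adj pal (H₁ i) (H₂ j) v)))

-- Fix v and a hash family h : [N] → [L] with a target value t (h(v) for an unmarked v, or a fixed
-- colour), and put Y_x = L·[h(x) = t] − 1 on the marked points x. Then m·d′(v) − d(v) and
-- (m−1)·p′(v) − p(v) are sums S = Σ Y_x. By c-wise independence, E[Y_w · Π_{x∈T} Y_x] = 0 whenever
-- w ∉ T and |T| + 2 ≤ c: summing over the value of h(w) first kills the term. Expanding
-- (S′ + Y_w)^{2j+2} to second order, the cross term vanishes and the remainder is at most
-- C_j·L²·(S′^{2j} + L^{2j}), so by induction on the number of points E[S^{2j}] ≤ γ_j·L^{2j}·(D+1)^j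
-- for D marked points. With j = 16 and m large, Markov's inequality bounds the probability of each of
-- the two deviations that make v bad by m^{-30} = ℓ^{-3}.
module Submission where

open import Defs
open import Data.Bool using (Bool; true; false; _∧_; not; if_then_else_; T)
open import Data.Fin using (Fin; zero; suc; toℕ; fromℕ<)
import Data.Fin as Fin
import Data.Fin.Properties as Finₚ
open import Data.Product using (∃; ∃-syntax; ∃₂; _×_; _,_; proj₁; proj₂)
open import Data.Sum using (_⊎_; inj₁; inj₂)
open import Data.Vec using (Vec; []; _∷_; lookup; map; tabulate)
open import Data.Vec.Properties using (lookup-map; map-∘; lookup∘tabulate; tabulate-cong; tabulate∘lookup)
open import Function using (_∘_; id)
open import Function.Definitions using (Injective)
open import Relation.Binary.PropositionalEquality
open import Relation.Nullary using (¬_; yes; no; does)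

module Arithmetic where

  open import Data.Nat
  open import Data.Nat.Properties
  open import Data.Nat.Tactic.RingSolver using (solve-∀)
  open import Data.Bool.Properties using (T-not-≡)
  open import Data.Empty using (⊥-elim)
  open import Function.Bundles using (Equivalence)
  open ≤-Reasoning

  ^-distribʳ-* : ∀ m n o → (m * n) ^ o ≡ m ^ o * n ^ o
  ^-distribʳ-* m n zero    = refl
  ^-distribʳ-* m n (suc o) = trans (cong (m * n *_) (^-distribʳ-* m n o)) (swap m n (m ^ o) (n ^ o))
    where
    swap : ∀ a b x y → a * b * (x * y) ≡ a * x * (b * y)
    swap = solve-∀

  [m+n]^o≤2^o*[m^o+n^o] : ∀ m n o → (m + n) ^ o ≤ 2 ^ o * (m ^ o + n ^ o)
  [m+n]^o≤2^o*[m^o+n^o] m n o with ≤-total m n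
  ... | inj₁ m≤n = begin
    (m + n) ^ o          ≤⟨ ^-monoˡ-≤ o (+-monoˡ-≤ n m≤n) ⟩
    (n + n) ^ o          ≡⟨ cong (λ x → (n + x) ^ o) (+-identityʳ n) ⟨
    (2 * n) ^ o          ≡⟨ ^-distribʳ-* 2 n o ⟩
    2 ^ o * n ^ o        ≤⟨ *-monoʳ-≤ (2 ^ o) (m≤n+m (n ^ o) (m ^ o)) ⟩
    2 ^ o * (m ^ o + n ^ o) ∎
  ... | inj₂ n≤m = begin
    (m + n) ^ o          ≤⟨ ^-monoˡ-≤ o (+-monoʳ-≤ m n≤m) ⟩
    (m + m) ^ o          ≡⟨ cong (λ x → (m + x) ^ o) (+-identityʳ m) ⟨
    (2 * m) ^ o          ≡⟨ ^-distribʳ-* 2 m o ⟩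
    2 ^ o * m ^ o        ≤⟨ *-monoʳ-≤ (2 ^ o) (m≤m+n (m ^ o) (n ^ o)) ⟩
    2 ^ o * (m ^ o + n ^ o) ∎

  twice : ℕ → ℕ
  twice zero    = 0
  twice (suc j) = suc (suc (twice j))

  remainderConstant : ℕ → ℕ
  remainderConstant j = (2 + twice j) * (2 + twice j) * 2 ^ twice j

  momentConstant : ℕ → ℕ
  momentConstant zero    = 1
  momentConstant (suc j) = remainderConstant j * (momentConstant j + 1)

  momentBound : (K L j D : ℕ) → ℕ
  momentBound K L j D = K * momentConstant j * L ^ twice j * suc D ^ j

  momentBound-step : ∀ K L j D →
    momentBound K L (suc j) D + remainderConstant j * (L * L) * (momentBound K L j D + K * L ^ twice j)
      ≤ momentBound K L (suc j) (suc D)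
  momentBound-step K L j D = begin
    K * (b * (g + 1)) * (L * (L * l)) * (suc D * x) + b * (L * L) * (K * g * l * x + K * l)
      ≤⟨ +-monoʳ-≤ (K * (b * (g + 1)) * (L * (L * l)) * (suc D * x))
           (*-monoʳ-≤ (b * (L * L)) (+-monoʳ-≤ (K * g * l * x) (m≤m*n (K * l) x {{m^n≢0 (suc D) j}}))) ⟩
    K * (b * (g + 1)) * (L * (L * l)) * (suc D * x) + b * (L * L) * (K * g * l * x + K * l * x)
      ≡⟨ collect K b g L l D x ⟩
    K * (b * (g + 1)) * (L * (L * l)) * (suc (suc D) * x)
      ≤⟨ *-monoʳ-≤ (K * (b * (g + 1)) * (L * (L * l))) (*-monoʳ-≤ (suc (suc D)) (^-monoˡ-≤ j (n≤1+n (suc D)))) ⟩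
    K * (b * (g + 1)) * (L * (L * l)) * (suc (suc D) * suc (suc D) ^ j) ∎
    where
    b = remainderConstant j
    g = momentConstant j
    l = L ^ twice j
    x = suc D ^ j
    collect : ∀ K b g L l D x →
      K * (b * (g + 1)) * (L * (L * l)) * (suc D * x) + b * (L * L) * (K * g * l * x + K * l * x)
        ≡ K * (b * (g + 1)) * (L * (L * l)) * (suc (suc D) * x)
    collect = solve-∀

  ≤ᵇ≡false⇒> : ∀ m n → (m ≤ᵇ n) ≡ false → n < m
  ≤ᵇ≡false⇒> m n m≰ᵇn = ≰⇒> (λ m≤n → subst T m≰ᵇn (≤⇒≤ᵇ m≤n))

  m+n≤o⇒n≤∣m-o∣ : ∀ m n o → m + n ≤ o → n ≤ ∣ m - o ∣
  m+n≤o⇒n≤∣m-o∣ m n o m+n≤o = begin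
    n          ≤⟨ m+n≤o⇒m≤o∸n n (≤-trans (≤-reflexive (+-comm n m)) m+n≤o) ⟩
    o ∸ m      ≤⟨ m∸n≤∣m-n∣ o m ⟩
    ∣ o - m ∣  ≡⟨ ∣-∣-comm o m ⟩
    ∣ m - o ∣  ∎

  degree-deviation : ∀ m d d′ → T (not (degOK m d d′)) → m ^ 7 ≤ ∣ m * d′ - d ∣
  degree-deviation m d d′ bad with d ≤ᵇ m * d′ + m ^ 7 in below | m * d′ ≤ᵇ d + m ^ 7 in above
  ... | false | _     = m+n≤o⇒n≤∣m-o∣ (m * d′) (m ^ 7) d (<⇒≤ (≤ᵇ≡false⇒> d _ below))
  ... | true  | false = subst (m ^ 7 ≤_) (∣-∣-comm d (m * d′))
                          (m+n≤o⇒n≤∣m-o∣ d (m ^ 7) (m * d′) (<⇒≤ (≤ᵇ≡false⇒> (m * d′) _ above)))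
  ... | true  | true  = ⊥-elim bad

  palette-deviation : ∀ m p p′ → 1 ≤ m → m ^ 10 < p → T (not (palOK m p p′)) → p ≤ 2 * m * ∣ (m ∸ 1) * p′ - p ∣
  palette-deviation m@(suc m₁) p p′ (s≤s z≤n) m¹⁰<p bad = begin
    p                        ≤⟨ m+n≤o⇒m≤o∸n p (≤-trans (≤-reflexive (+-comm p _)) 2mA+p≤2mp) ⟩
    2 * m * p ∸ 2 * m * A    ≡⟨ *-distribˡ-∸ (2 * m) p A ⟨
    2 * m * (p ∸ A)          ≡⟨ cong (2 * m *_) (m≤n⇒∣m-n∣≡n∸m A≤p) ⟨
    2 * m * ∣ A - p ∣         ∎
    where
    A = m₁ * p′
    mp′≤p+m⁸ : m * p′ ≤ p + m ^ 8
    mp′≤p+m⁸ = <⇒≤ (≤ᵇ≡false⇒> (p + m ^ 8) (m * p′) (Equivalence.to T-not-≡ bad))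
    2m₁m⁸≤p : 2 * m₁ * m ^ 8 ≤ p
    2m₁m⁸≤p = begin
      2 * m₁ * m ^ 8       ≤⟨ *-monoˡ-≤ (m ^ 8) (≤-trans (m≤m+n (2 * m₁) _) (≤-reflexive (square m₁))) ⟩
      m * m * m ^ 8        ≡⟨ *-assoc m m (m ^ 8) ⟩
      m ^ 10               ≤⟨ <⇒≤ m¹⁰<p ⟩
      p                    ∎
      where
      square : ∀ k → 2 * k + (1 + k * k) ≡ suc k * suc k
      square = solve-∀
    2mA+p≤2mp : 2 * m * A + p ≤ 2 * m * p
    2mA+p≤2mp = begin
      2 * m * A + p                      ≡⟨ cong (_+ p) (regroup m₁ p′) ⟩
      2 * m₁ * (m * p′) + p              ≤⟨ +-monoˡ-≤ p (*-monoʳ-≤ (2 * m₁) mp′≤p+m⁸) ⟩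
      2 * m₁ * (p + m ^ 8) + p           ≡⟨ cong (_+ p) (*-distribˡ-+ (2 * m₁) p (m ^ 8)) ⟩
      2 * m₁ * p + 2 * m₁ * m ^ 8 + p    ≤⟨ +-monoˡ-≤ p (+-monoʳ-≤ (2 * m₁ * p) 2m₁m⁸≤p) ⟩
      2 * m₁ * p + p + p                 ≡⟨ collect m₁ p ⟩
      2 * m * p                          ∎
      where
      regroup : ∀ k x → 2 * suc k * (k * x) ≡ 2 * k * (suc k * x)
      regroup = solve-∀
      collect : ∀ k x → 2 * k * x + x + x ≡ 2 * suc k * x
      collect = solve-∀
    A≤p : A ≤ p
    A≤p = *-cancelˡ-≤ (2 * m) (≤-trans (m≤m+n (2 * m * A) p) 2mA+p≤2mp)

  m*o≤n*p⇒p*q≤o⇒m*q≤n : ∀ m n o p q → 0 < o → m * o ≤ n * p → p * q ≤ o → m * q ≤ n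
  m*o≤n*p⇒p*q≤o⇒m*q≤n m n o p q o>0 mo≤np pq≤o = *-cancelʳ-≤ (m * q) n o {{>-nonZero o>0}} (begin
    m * q * o     ≡⟨ reorder₁ m q o ⟩
    q * (m * o)   ≤⟨ *-monoʳ-≤ q mo≤np ⟩
    q * (n * p)   ≡⟨ reorder₂ q n p ⟩
    n * (p * q)   ≤⟨ *-monoʳ-≤ n pq≤o ⟩
    n * o         ∎)
    where
    reorder₁ : ∀ m q o → m * q * o ≡ q * (m * o)
    reorder₁ = solve-∀
    reorder₂ : ∀ q n p → q * (n * p) ≡ n * (p * q)
    reorder₂ = solve-∀

  degree-threshold : ∀ g m d → 2 ≤ m → g * 2 ^ 16 ≤ m → d ≤ m ^ 10 + m ^ 7 →
                     g * m ^ 32 * suc d ^ 16 * m ^ 30 ≤ (m ^ 7) ^ 32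
  degree-threshold g m d m≥2 g2¹⁶≤m d≤ = begin
    g * m ^ 32 * suc d ^ 16 * m ^ 30          ≤⟨ *-monoˡ-≤ (m ^ 30) (*-monoʳ-≤ (g * m ^ 32) (^-monoˡ-≤ 16 1+d≤2m¹⁰)) ⟩
    g * m ^ 32 * (2 * m ^ 10) ^ 16 * m ^ 30   ≡⟨ cong (λ x → g * m ^ 32 * x * m ^ 30)
                                                    (trans (^-distribʳ-* 2 (m ^ 10) 16) (cong (2 ^ 16 *_) (^-*-assoc m 10 16))) ⟩
    g * m ^ 32 * (2 ^ 16 * m ^ 160) * m ^ 30  ≡⟨ regroup g (2 ^ 16) (m ^ 32) (m ^ 160) (m ^ 30) ⟩
    g * 2 ^ 16 * (m ^ 32 * m ^ 160 * m ^ 30)  ≡⟨ cong (g * 2 ^ 16 *_) (trans (cong (_* m ^ 30) (sym (^-distribˡ-+-* m 32 160)))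
                                                                          (sym (^-distribˡ-+-* m 192 30))) ⟩
    g * 2 ^ 16 * m ^ 222                      ≤⟨ *-monoˡ-≤ (m ^ 222) g2¹⁶≤m ⟩
    m ^ 223                                   ≤⟨ ^-monoʳ-≤ m {{>-nonZero (≤-trans (s≤s z≤n) m≥2)}} (n≤1+n 223) ⟩
    m ^ 224                                   ≡⟨ ^-*-assoc m 7 32 ⟨
    (m ^ 7) ^ 32                              ∎
    where
    regroup : ∀ g t a b c → g * a * (t * b) * c ≡ g * t * (a * b * c)
    regroup = solve-∀
    1+d≤2m¹⁰ : suc d ≤ 2 * m ^ 10
    1+d≤2m¹⁰ = begin
      suc d              ≤⟨ s≤s d≤ ⟩
      suc (m ^ 10 + m ^ 7) ≡⟨ +-suc (m ^ 10) (m ^ 7) ⟨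
      m ^ 10 + suc (m ^ 7) ≤⟨ +-monoʳ-≤ (m ^ 10) (^-monoʳ-< m m≥2 {7} {10} (m≤m+n 8 2)) ⟩
      m ^ 10 + m ^ 10     ≡⟨ cong (m ^ 10 +_) (+-identityʳ (m ^ 10)) ⟨
      2 * m ^ 10          ∎

  palette-threshold : ∀ g m p → 1 ≤ m → g * 2 ^ 48 ≤ m → m ^ 10 < p →
                      (2 * m) ^ 32 * (g * (m ∸ 1) ^ 32 * suc p ^ 16) * m ^ 30 ≤ p ^ 32
  palette-threshold g m p m≥1 g2⁴⁸≤m m¹⁰<p = begin
    (2 * m) ^ 32 * (g * (m ∸ 1) ^ 32 * suc p ^ 16) * m ^ 30
      ≤⟨ *-monoˡ-≤ (m ^ 30) (*-mono-≤ (≤-reflexive (^-distribʳ-* 2 m 32))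
           (*-mono-≤ (*-monoʳ-≤ g (^-monoˡ-≤ 32 (m∸n≤m m 1))) 1+p¹⁶≤)) ⟩
    (2 ^ 32 * m ^ 32) * (g * m ^ 32 * (2 ^ 16 * p ^ 16)) * m ^ 30
      ≡⟨ regroup (2 ^ 32) (m ^ 32) g (2 ^ 16) (p ^ 16) (m ^ 30) ⟩
    g * (2 ^ 32 * 2 ^ 16) * (m ^ 32 * m ^ 32 * m ^ 30 * p ^ 16)
      ≡⟨ cong₂ (λ x y → g * x * (y * p ^ 16)) (sym (^-distribˡ-+-* 2 32 16))
               (trans (cong (_* m ^ 30) (sym (^-distribˡ-+-* m 32 32))) (sym (^-distribˡ-+-* m 64 30))) ⟩
    g * 2 ^ 48 * (m ^ 94 * p ^ 16)   ≤⟨ *-monoˡ-≤ (m ^ 94 * p ^ 16) g2⁴⁸≤m ⟩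
    m * (m ^ 94 * p ^ 16)            ≡⟨ *-assoc m (m ^ 94) (p ^ 16) ⟨
    m ^ 95 * p ^ 16                  ≤⟨ *-monoˡ-≤ (p ^ 16) (^-monoʳ-≤ m {{>-nonZero m≥1}} (m≤m+n 95 65)) ⟩
    m ^ 160 * p ^ 16                 ≡⟨ cong (_* p ^ 16) (^-*-assoc m 10 16) ⟨
    (m ^ 10) ^ 16 * p ^ 16           ≤⟨ *-monoˡ-≤ (p ^ 16) (^-monoˡ-≤ 16 (<⇒≤ m¹⁰<p)) ⟩
    p ^ 16 * p ^ 16                  ≡⟨ ^-distribˡ-+-* p 16 16 ⟨
    p ^ 32                           ∎
    where
    regroup : ∀ a b g e q c → a * b * (g * b * (e * q)) * c ≡ g * (a * e) * (b * b * c * q)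
    regroup = solve-∀
    1+p¹⁶≤ : suc p ^ 16 ≤ 2 ^ 16 * p ^ 16
    1+p¹⁶≤ = ≤-trans (^-monoˡ-≤ 16 (+-monoˡ-≤ p (≤-trans (s≤s z≤n) m¹⁰<p)))
                     (≤-reflexive (trans (cong (λ x → (p + x) ^ 16) (sym (+-identityʳ p))) (^-distribʳ-* 2 p 16)))

  m^10<p≤n^2⇒m≤n : ∀ m n p → m ^ 10 < p → p ≤ n ^ 2 → m ≤ n
  m^10<p≤n^2⇒m≤n m n p m¹⁰<p p≤n² = ≮⇒≥ λ n<m → <-irrefl refl (begin-strict
    m ^ 10   <⟨ m¹⁰<p ⟩
    p        ≤⟨ p≤n² ⟩
    n ^ 2    ≤⟨ ^-monoˡ-≤ 2 (<⇒≤ n<m) ⟩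
    m ^ 2    ≤⟨ ^-monoʳ-≤ m {{>-nonZero (≤-<-trans z≤n n<m)}} {2} {10} (s≤s (s≤s z≤n)) ⟩
    m ^ 10   ∎)

module MomentMethod where

  open import Data.Integer
    using (ℤ; +_; -[1+_]; 0ℤ; 1ℤ; -1ℤ; _+_; _-_; -_; _*_; _^_; ∣_∣; _≤_; +≤+; -≤+)
  open import Data.Integer.Properties
  import Data.Nat as ℕ
  import Data.Nat.Properties as ℕₚ
  open import Data.Vec.Relation.Unary.Any using (here; there; index)
  open import Data.Vec.Relation.Unary.Any.Properties using (lookup-index)
  open import Data.Vec.Relation.Unary.All using (All; []; _∷_)
  open import Data.Vec.Relation.Unary.Unique.Propositional using (Unique; []; _∷_)
  open import Data.Vec.Relation.Unary.Unique.Propositional.Properties using (lookup-injective)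
  open import Data.Vec.Membership.Propositional using (_∈_; _∉_)
  open import Data.Vec.Membership.Propositional.Properties using (∈-lookup)
  open import Relation.Nullary using (¬?)
  open import Relation.Nullary.Decidable using (decidable-stable; dec-true; dec-false)
  open import Data.Empty using (⊥; ⊥-elim)
  open import Algebra.Properties.Semiring.Sum +-*-semiring
    using (sum; sum-syntax; sum-cong-≗; ∑-comm; ∑-distrib-+; *-distribˡ-sum; *-distribʳ-sum; sum-replicate-zero)
  open import Data.Integer.Tactic.RingSolver using (solve-∀)
  import Data.Nat.Tactic.RingSolver as ℕ-Solver
  open Arithmetic using (^-distribʳ-*; [m+n]^o≤2^o*[m^o+n^o]; twice; remainderConstant; momentBound; momentBound-step;
                         degree-deviation; palette-deviation)

  𝟙 : Bool → ℤ
  𝟙 true  = 1ℤ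
  𝟙 false = 0ℤ

  sum-zero : ∀ {k} {f : Fin k → ℤ} → (∀ i → f i ≡ 0ℤ) → sum f ≡ 0ℤ
  sum-zero {k} f≡0 = trans (sum-cong-≗ f≡0) (sum-replicate-zero k)

  sum-const : ∀ {k} (x : ℤ) → ∑[ i < k ] x ≡ + k * x
  sum-const {ℕ.zero}  x = refl
  sum-const {ℕ.suc k} x = begin
    x + ∑[ i < k ] x    ≡⟨ cong (_+_ x) (sum-const {k} x) ⟩
    x + + k * x         ≡⟨ cong (_+ + k * x) (*-identityˡ x) ⟨
    1ℤ * x + + k * x    ≡⟨ *-distribʳ-+ x 1ℤ (+ k) ⟨
    + ℕ.suc k * x       ∎
    where open ≡-Reasoning

  sum-neg : ∀ {k} (f : Fin k → ℤ) → ∑[ i < k ] (- f i) ≡ - sum f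
  sum-neg f = trans (sum-cong-≗ (λ i → sym (-1*i≡-i (f i))))
                    (trans (sym (*-distribˡ-sum -1ℤ f)) (-1*i≡-i (sum f)))

  sum-sub : ∀ {k} (f g : Fin k → ℤ) → ∑[ i < k ] (f i - g i) ≡ sum f - sum g
  sum-sub f g = trans (∑-distrib-+ f (λ i → - g i)) (cong (_+_ (sum f)) (sum-neg g))

  sum-mono-≤ : ∀ {k} {f g : Fin k → ℤ} → (∀ i → f i ≤ g i) → sum f ≤ sum g
  sum-mono-≤ {ℕ.zero}  f≤g = ≤-refl
  sum-mono-≤ {ℕ.suc k} f≤g = +-mono-≤ (f≤g zero) (sum-mono-≤ (f≤g ∘ suc))

  sum-𝟙 : ∀ {k} (P : Fin k → Bool) → ∑[ i < k ] 𝟙 (P i) ≡ + count P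
  sum-𝟙 {ℕ.zero}  P = refl
  sum-𝟙 {ℕ.suc k} P with P zero
  ... | true  = cong (_+_ 1ℤ) (sum-𝟙 (P ∘ suc))
  ... | false = trans (+-identityˡ _) (sum-𝟙 (P ∘ suc))

  sum-𝟙-* : ∀ {k} (P : Fin k → Bool) (x : ℤ) → ∑[ i < k ] (𝟙 (P i) * x) ≡ + count P * x
  sum-𝟙-* P x = trans (sym (*-distribʳ-sum x (𝟙 ∘ P))) (cong (_* x) (sum-𝟙 P))

  sum-δ : ∀ {k} (a : Fin k) (f : Fin k → ℤ) → ∑[ b < k ] (𝟙 (a =ᶠ b) * f b) ≡ f a
  sum-δ {ℕ.suc k} zero f =
    trans (cong (_+_ (1ℤ * f zero)) (sum-zero {k} (λ _ → refl))) (trans (+-identityʳ _) (*-identityˡ _))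
  sum-δ {ℕ.suc k} (suc a) f = trans (+-identityˡ _) (sum-δ a (f ∘ suc))

  markov : ∀ {k} (B : Fin k → Bool) (F : Fin k → ℤ) (x : ℤ) →
           (∀ i → 0ℤ ≤ F i) → (∀ i → T (B i) → x ≤ F i) → + count B * x ≤ sum F
  markov B F x F≥0 x≤F = ≤-trans (≤-reflexive (sym (sum-𝟙-* B x))) (sum-mono-≤ pointwise)
    where
    pointwise : ∀ i → 𝟙 (B i) * x ≤ F i
    pointwise i with B i | x≤F i
    ... | true  | x≤Fi = ≤-trans (≤-reflexive (*-identityˡ x)) (x≤Fi _)
    ... | false | _    = F≥0 i

  =ᶠ-sym : ∀ {k} (a b : Fin k) → (a =ᶠ b) ≡ (b =ᶠ a)
  =ᶠ-sym a b with a Fin.≟ b | b Fin.≟ a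
  ... | yes _   | yes _   = refl
  ... | no  _   | no  _   = refl
  ... | yes a≡b | no  b≢a = ⊥-elim (b≢a (sym a≡b))
  ... | no  a≢b | yes b≡a = ⊥-elim (a≢b (sym b≡a))

  count-cong : ∀ {k} {P Q : Fin k → Bool} → (∀ i → P i ≡ Q i) → count P ≡ count Q
  count-cong {ℕ.zero}  P≗Q = refl
  count-cong {ℕ.suc k} P≗Q = cong₂ (λ b n → (if b then 1 else 0) ℕ.+ n) (P≗Q zero) (count-cong (P≗Q ∘ suc))

  =ᶠ-fromℕ< : ∀ {k t} (a : Fin k) (t<k : t ℕ.< k) → (a =ᶠ fromℕ< t<k) ≡ does (toℕ a ℕ.≟ t)
  =ᶠ-fromℕ< {t = t} a t<k with a Fin.≟ fromℕ< t<k
  ... | yes a≡t = sym (dec-true (toℕ a ℕ.≟ t) (trans (cong toℕ a≡t) (Finₚ.toℕ-fromℕ< t<k)))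
  ... | no  a≢t =
    sym (dec-false (toℕ a ℕ.≟ t) (λ a≡t → a≢t (Finₚ.toℕ-injective (trans a≡t (sym (Finₚ.toℕ-fromℕ< t<k))))))

  ∑ᵛ : ∀ {L} c → (Vec (Fin L) c → ℤ) → ℤ
  ∑ᵛ         ℕ.zero    G = G []
  ∑ᵛ {L} (ℕ.suc c) G = ∑[ a < L ] ∑ᵛ c (λ ys → G (a ∷ ys))

  ∑ᵛ-cong : ∀ {L} c {G G′ : Vec (Fin L) c → ℤ} → (∀ ys → G ys ≡ G′ ys) → ∑ᵛ c G ≡ ∑ᵛ c G′
  ∑ᵛ-cong ℕ.zero    G≗G′ = G≗G′ []
  ∑ᵛ-cong (ℕ.suc c) G≗G′ = sum-cong-≗ (λ a → ∑ᵛ-cong c (λ ys → G≗G′ (a ∷ ys)))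

  *-distribˡ-∑ᵛ : ∀ {L} c (x : ℤ) (G : Vec (Fin L) c → ℤ) → x * ∑ᵛ c G ≡ ∑ᵛ c (λ ys → x * G ys)
  *-distribˡ-∑ᵛ ℕ.zero    x G = refl
  *-distribˡ-∑ᵛ (ℕ.suc c) x G =
    trans (*-distribˡ-sum x (λ a → ∑ᵛ c (λ ys → G (a ∷ ys))))
          (sum-cong-≗ (λ a → *-distribˡ-∑ᵛ c x (λ ys → G (a ∷ ys))))

  ∑-∑ᵛ-comm : ∀ {L k} c (G : Fin k → Vec (Fin L) c → ℤ) →
              ∑[ i < k ] ∑ᵛ c (G i) ≡ ∑ᵛ c (λ ys → ∑[ i < k ] G i ys)
  ∑-∑ᵛ-comm ℕ.zero    G = refl
  ∑-∑ᵛ-comm (ℕ.suc c) G =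
    trans (∑-comm (λ i a → ∑ᵛ c (λ ys → G i (a ∷ ys))))
          (sum-cong-≗ (λ a → ∑-∑ᵛ-comm c (λ i ys → G i (a ∷ ys))))

  ∑ᵛ-δ : ∀ {L} c (f : Fin c → Fin L) (G : Vec (Fin L) c → ℤ) →
         ∑ᵛ c (λ ys → 𝟙 (allF (λ j → f j =ᶠ lookup ys j)) * G ys) ≡ G (tabulate f)
  ∑ᵛ-δ ℕ.zero    f G = *-identityˡ (G [])
  ∑ᵛ-δ {L} (ℕ.suc c) f G = begin
    ∑[ b < L ] ∑ᵛ c (λ ys → 𝟙 ((f zero =ᶠ b) ∧ hits ys) * G (b ∷ ys))
      ≡⟨ sum-cong-≗ (λ b → trans (∑ᵛ-cong c (λ ys → 𝟙-∧-* (f zero =ᶠ b) (hits ys) (G (b ∷ ys))))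
                                 (sym (*-distribˡ-∑ᵛ c (𝟙 (f zero =ᶠ b)) (λ ys → 𝟙 (hits ys) * G (b ∷ ys))))) ⟩
    ∑[ b < L ] (𝟙 (f zero =ᶠ b) * ∑ᵛ c (λ ys → 𝟙 (hits ys) * G (b ∷ ys)))
      ≡⟨ sum-δ (f zero) (λ b → ∑ᵛ c (λ ys → 𝟙 (hits ys) * G (b ∷ ys))) ⟩
    ∑ᵛ c (λ ys → 𝟙 (hits ys) * G (f zero ∷ ys))
      ≡⟨ ∑ᵛ-δ c (f ∘ suc) (λ ys → G (f zero ∷ ys)) ⟩
    G (tabulate f) ∎
    where
    open ≡-Reasoning
    hits : Vec (Fin L) c → Bool
    hits ys = allF (λ j → f (suc j) =ᶠ lookup ys j)
    𝟙-∧-* : ∀ x y (g : ℤ) → 𝟙 (x ∧ y) * g ≡ 𝟙 x * (𝟙 y * g)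
    𝟙-∧-* true  y g = sym (*-identityˡ _)
    𝟙-∧-* false y g = refl

  ∑ᵛ-zero : ∀ {L} c → ∑ᵛ {L} c (λ _ → 0ℤ) ≡ 0ℤ
  ∑ᵛ-zero ℕ.zero    = refl
  ∑ᵛ-zero {L} (ℕ.suc c) = sum-zero {L} (λ _ → ∑ᵛ-zero c)

  ∏ : ∀ {q} → Vec ℤ q → ℤ
  ∏ []       = 1ℤ
  ∏ (x ∷ xs) = x * ∏ xs

  sum^≡∑ᵛ∏ : ∀ {r} q (f : Fin r → ℤ) → sum f ^ q ≡ ∑ᵛ q (λ t → ∏ (map f t))
  sum^≡∑ᵛ∏ ℕ.zero    f = refl
  sum^≡∑ᵛ∏ {r} (ℕ.suc q) f = begin
    sum f * sum f ^ q                                     ≡⟨ cong (_*_ (sum f)) (sum^≡∑ᵛ∏ q f) ⟩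
    sum f * ∑ᵛ q (λ t → ∏ (map f t))                      ≡⟨ *-distribʳ-sum (∑ᵛ q (λ t → ∏ (map f t))) f ⟩
    ∑[ a < r ] (f a * ∑ᵛ q (λ t → ∏ (map f t)))           ≡⟨ sum-cong-≗ (λ a → *-distribˡ-∑ᵛ q (f a) (λ t → ∏ (map f t))) ⟩
    ∑[ a < r ] ∑ᵛ q (λ t → f a * ∏ (map f t))             ∎
    where open ≡-Reasoning

  module _ {N : ℕ.ℕ} where

    open import Data.Vec.Membership.DecPropositional (Fin._≟_ {N}) using (_∈?_)

    ∉⇒All≢ : ∀ {q} {x : Fin N} {xs : Vec (Fin N) q} → x ∉ xs → All (λ y → ¬ x ≡ y) xs
    ∉⇒All≢ {xs = []}     x∉xs = []
    ∉⇒All≢ {xs = y ∷ xs} x∉xs = (x∉xs ∘ here) ∷ ∉⇒All≢ (x∉xs ∘ there)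

    fresh : ∀ {q} (xs : Vec (Fin N) q) → q ℕ.< N → ∃ λ z → z ∉ xs
    fresh {q} xs q<N with Finₚ.any? (λ z → ¬? (z ∈? xs))
    ... | yes z∉xs = z∉xs
    ... | no  ¬∃z∉ = ⊥-elim (collision (Finₚ.pigeonhole q<N position))
      where
      covered : ∀ z → z ∈ xs
      covered z = decidable-stable (z ∈? xs) (λ z∉xs → ¬∃z∉ (z , z∉xs))
      position : Fin N → Fin q
      position z = index (covered z)
      collision : ∃₂ (λ i j → i Fin.< j × position i ≡ position j) → ⊥
      collision (i , j , i<j , same) = Finₚ.<-irrefl
        (trans (lookup-index (covered i)) (trans (cong (lookup xs) same) (sym (lookup-index (covered j)))))
        i<j

    dedup : ∀ {s} (zs : Vec (Fin N) s) → ∃₂ λ p (ds : Vec (Fin N) p) →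
            p ℕ.≤ s × Unique ds × (∀ {x} → x ∈ zs → x ∈ ds) × (∀ {x} → x ∈ ds → x ∈ zs)
    dedup [] = 0 , [] , ℕ.z≤n , [] , (λ ()) , (λ ())
    dedup (z ∷ zs) with dedup zs
    ... | p , ds , p≤s , ds! , zs⊆ds , ds⊆zs with z ∈? ds
    ...   | yes z∈ds = p , ds , ℕₚ.m≤n⇒m≤1+n p≤s , ds! , z∷zs⊆ds , there ∘ ds⊆zs
      where
      z∷zs⊆ds : ∀ {x} → x ∈ z ∷ zs → x ∈ ds
      z∷zs⊆ds (here refl) = z∈ds
      z∷zs⊆ds (there x∈zs) = zs⊆ds x∈zs
    ...   | no  z∉ds = ℕ.suc p , z ∷ ds , ℕ.s≤s p≤s , ∉⇒All≢ z∉ds ∷ ds! , ∷-mono zs⊆ds , ∷-mono ds⊆zs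
      where
      ∷-mono : ∀ {a b} {as : Vec (Fin N) a} {bs : Vec (Fin N) b} →
               (∀ {x} → x ∈ as → x ∈ bs) → ∀ {x} → x ∈ z ∷ as → x ∈ z ∷ bs
      ∷-mono as⊆bs (here x≡z)   = here x≡z
      ∷-mono as⊆bs (there x∈as) = there (as⊆bs x∈as)

    extend : ∀ {p c′} (w : Fin N) (ds : Vec (Fin N) p) → Unique (w ∷ ds) → p ℕ.≤′ c′ → c′ ℕ.< N →
             ∃ λ (rest : Vec (Fin N) c′) → Unique (w ∷ rest) × (∀ {x} → x ∈ ds → x ∈ rest)
    extend w ds w∷ds! ℕ.≤′-refl _ = ds , w∷ds! , id
    extend w ds w∷ds! (ℕ.≤′-step p≤′c′) c′<N with extend w ds w∷ds! p≤′c′ (ℕₚ.<⇒≤ c′<N)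
    ... | rest , (w∉rest ∷ rest!) , ds⊆rest with fresh (w ∷ rest) c′<N
    ...   | z , z∉w∷rest =
      z ∷ rest , ((z∉w∷rest ∘ here ∘ sym) ∷ w∉rest) ∷ ∉⇒All≢ (z∉w∷rest ∘ there) ∷ rest! , there ∘ ds⊆rest

  -- c-wise independent families

  module Independent {K N L c : ℕ.ℕ} (H : Fin K → Fin N → Fin L) (indep : CWiseIndependent c K N L H) where

    ∑-family≡∑ᵛ : (xs : Fin c → Fin N) → Injective _≡_ _≡_ xs → (G : Vec (Fin L) c → ℤ) →
                  + (L ℕ.^ c) * ∑[ i < K ] G (tabulate (H i ∘ xs)) ≡ + K * ∑ᵛ c G
    ∑-family≡∑ᵛ xs xs-inj G = begin
      + (L ℕ.^ c) * ∑[ i < K ] G (tabulate (H i ∘ xs))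
        ≡⟨ cong (_*_ (+ (L ℕ.^ c))) (trans (sum-cong-≗ (λ i → sym (∑ᵛ-δ c (H i ∘ xs) G)))
                                           (∑-∑ᵛ-comm c (λ i ys → 𝟙 (hits i ys) * G ys))) ⟩
      + (L ℕ.^ c) * ∑ᵛ c (λ ys → ∑[ i < K ] (𝟙 (hits i ys) * G ys))
        ≡⟨ *-distribˡ-∑ᵛ c (+ (L ℕ.^ c)) _ ⟩
      ∑ᵛ c (λ ys → + (L ℕ.^ c) * ∑[ i < K ] (𝟙 (hits i ys) * G ys))
        ≡⟨ ∑ᵛ-cong c (λ ys → cong (_*_ (+ (L ℕ.^ c))) (sum-𝟙-* (λ i → hits i ys) (G ys))) ⟩
      ∑ᵛ c (λ ys → + (L ℕ.^ c) * (+ count (λ i → hits i ys) * G ys))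
        ≡⟨ ∑ᵛ-cong c (λ ys → trans (sym (*-assoc (+ (L ℕ.^ c)) (+ count (λ i → hits i ys)) (G ys)))
                                   (cong (_* G ys) (uniform ys))) ⟩
      ∑ᵛ c (λ ys → + K * G ys)
        ≡⟨ *-distribˡ-∑ᵛ c (+ K) G ⟨
      + K * ∑ᵛ c G ∎
      where
      open ≡-Reasoning
      hits : Fin K → Vec (Fin L) c → Bool
      hits i ys = allF (λ j → H i (xs j) =ᶠ lookup ys j)
      uniform : ∀ ys → + (L ℕ.^ c) * + count (λ i → hits i ys) ≡ + K
      uniform ys = trans (*-comm (+ (L ℕ.^ c)) _)
                         (trans (sym (pos-* (count (λ i → hits i ys)) _)) (cong +_ (indep xs xs-inj (lookup ys))))

    ∑-family-vanishes : 0 ℕ.< L → (xs : Fin c → Fin N) → Injective _≡_ _≡_ xs →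
                        (G : Vec (Fin L) c → ℤ) → ∑ᵛ c G ≡ 0ℤ → ∑[ i < K ] G (tabulate (H i ∘ xs)) ≡ 0ℤ
    ∑-family-vanishes L>0 xs xs-inj G ∑G≡0
      with i*j≡0⇒i≡0∨j≡0 (+ (L ℕ.^ c)) (trans (∑-family≡∑ᵛ xs xs-inj G) (trans (cong (_*_ (+ K)) ∑G≡0) (*-zeroʳ (+ K))))
    ... | inj₂ ∑≡0 = ∑≡0
    ... | inj₁ Lᶜ≡0 = ⊥-elim (ℕ.≢-nonZero⁻¹ (L ℕ.^ c) {{ℕₚ.m^n≢0 L c {{ℕ.>-nonZero L>0}}}} (+-injective Lᶜ≡0))

    ∑-family-centred : c ℕ.≤ N → 0 ℕ.< L → ∀ {s} (w : Fin N) (zs : Vec (Fin N) s) → s ℕ.< c → w ∉ zs →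
                       (Φ : Fin L → Vec (Fin L) s → ℤ) → (∀ ys → ∑[ a < L ] Φ a ys ≡ 0ℤ) →
                       ∑[ i < K ] Φ (H i w) (map (H i) zs) ≡ 0ℤ
    -- Complete w followed by the distinct points of zs to c distinct points; as a function of the
    -- hash values at these points the summand is centred in the first coordinate.
    ∑-family-centred c≤N L>0 {s} w zs (ℕ.s≤s {n = c′} s≤c′) w∉zs Φ centred
      with dedup zs
    ... | p , ds , p≤s , ds! , zs⊆ds , ds⊆zs
      with extend w ds (∉⇒All≢ (w∉zs ∘ ds⊆zs) ∷ ds!) (ℕₚ.≤⇒≤′ (ℕₚ.≤-trans p≤s s≤c′)) c≤N
    ... | rest , w∷rest! , ds⊆rest = begin
      ∑[ i < K ] Φ (H i w) (map (H i) zs)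
        ≡⟨ sum-cong-≗ (λ i → cong (Φ (H i w)) (map-through-rest i)) ⟩
      ∑[ i < K ] G (tabulate (H i ∘ lookup (w ∷ rest)))
        ≡⟨ ∑-family-vanishes L>0 (lookup (w ∷ rest)) (lookup-injective w∷rest! _ _) G ∑G≡0 ⟩
      0ℤ ∎
      where
      open ≡-Reasoning
      ι : Fin s → Fin c′
      ι k = index (ds⊆rest (zs⊆ds (∈-lookup k zs)))
      restrict : Vec (Fin L) c′ → Vec (Fin L) s
      restrict ys = tabulate (λ k → lookup ys (ι k))
      G : Vec (Fin L) (ℕ.suc c′) → ℤ
      G (a ∷ ys) = Φ a (restrict ys)
      map-through-rest : ∀ i → map (H i) zs ≡ restrict (tabulate (H i ∘ lookup rest))
      map-through-rest i = begin
        map (H i) zs                                ≡⟨ tabulate∘lookup (map (H i) zs) ⟨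
        tabulate (lookup (map (H i) zs))            ≡⟨ tabulate-cong (λ k → trans (lookup-map k (H i) zs)
                                                         (trans (cong (H i) (lookup-index (ds⊆rest (zs⊆ds (∈-lookup k zs)))))
                                                           (sym (lookup∘tabulate (H i ∘ lookup rest) (ι k))))) ⟩
        restrict (tabulate (H i ∘ lookup rest))     ∎
      ∑G≡0 : ∑ᵛ (ℕ.suc c′) G ≡ 0ℤ
      ∑G≡0 = trans (∑-∑ᵛ-comm c′ (λ a ys → Φ a (restrict ys)))
                   (trans (∑ᵛ-cong c′ (λ ys → centred (restrict ys))) (∑ᵛ-zero c′))


  -- Second-order expansion of even powers

  ∣+m-+n∣≡∣m-n∣ : ∀ m n → ∣ + m - + n ∣ ≡ ℕ.∣ m - n ∣
  ∣+m-+n∣≡∣m-n∣ m n with ℕₚ.≤-total m n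
  ... | inj₁ m≤n = trans (cong ∣_∣ (m-n≡m⊖n m n)) (trans (∣⊖∣-≤ m≤n) (sym (ℕₚ.m≤n⇒∣m-n∣≡n∸m m≤n)))
  ... | inj₂ n≤m = trans (cong ∣_∣ (m-n≡m⊖n m n)) (trans (∣m⊖n∣≡∣n⊖m∣ m n)
                     (trans (∣⊖∣-≤ n≤m) (sym (trans (ℕₚ.∣-∣-comm m n) (ℕₚ.m≤n⇒∣m-n∣≡n∸m n≤m)))))

  i≤+∣i∣ : ∀ i → i ≤ + ∣ i ∣
  i≤+∣i∣ (+ n)    = ≤-refl
  i≤+∣i∣ -[1+ n ] = -≤+

  ∣i^n∣≡∣i∣^n : ∀ i n → ∣ i ^ n ∣ ≡ ∣ i ∣ ℕ.^ n
  ∣i^n∣≡∣i∣^n i ℕ.zero    = refl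
  ∣i^n∣≡∣i∣^n i (ℕ.suc n) = trans (abs-* i (i ^ n)) (cong (ℕ._*_ ∣ i ∣) (∣i^n∣≡∣i∣^n i n))

  i^[twice-n]≡+∣i∣^[twice-n] : ∀ i n → i ^ twice n ≡ + (∣ i ∣ ℕ.^ twice n)
  i^[twice-n]≡+∣i∣^[twice-n] i ℕ.zero    = refl
  i^[twice-n]≡+∣i∣^[twice-n] i (ℕ.suc n) = begin
    i * (i * i ^ twice n)                                 ≡⟨ *-assoc i i _ ⟨
    i * i * i ^ twice n                                   ≡⟨ cong₂ _*_ (square i) (i^[twice-n]≡+∣i∣^[twice-n] i n) ⟩
    + (∣ i ∣ ℕ.* ∣ i ∣) * + (∣ i ∣ ℕ.^ twice n)           ≡⟨ pos-* (∣ i ∣ ℕ.* ∣ i ∣) _ ⟨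
    + (∣ i ∣ ℕ.* ∣ i ∣ ℕ.* ∣ i ∣ ℕ.^ twice n)             ≡⟨ cong +_ (ℕₚ.*-assoc ∣ i ∣ ∣ i ∣ _) ⟩
    + (∣ i ∣ ℕ.^ twice (ℕ.suc n))                         ∎
    where
    open ≡-Reasoning
    square : ∀ i → i * i ≡ + (∣ i ∣ ℕ.* ∣ i ∣)
    square (+ n)    = sym (pos-* n n)
    square -[1+ n ] = refl

  remainder : ℕ.ℕ → ℤ → ℤ → ℤ
  remainder q s y = (s + y) ^ (2 ℕ.+ q) - s ^ (2 ℕ.+ q) - + (2 ℕ.+ q) * (s ^ (1 ℕ.+ q) * y)

  remainder-zero : ∀ s y → remainder 0 s y ≡ y * y
  remainder-zero = square-expansion
    where
    square-expansion : ∀ s y → (s + y) * ((s + y) * 1ℤ) - s * (s * 1ℤ) - + 2 * (s * 1ℤ * y) ≡ y * y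
    square-expansion = solve-∀

  remainder-suc : ∀ q s y → remainder (ℕ.suc q) s y ≡ (s + y) * remainder q s y + + (2 ℕ.+ q) * (s ^ (1 ℕ.+ q) * (y * y))
  remainder-suc q s y = trans
    (cong (λ n → (s + y) * (s + y) ^ (2 ℕ.+ q) - s * (s * s ^ (1 ℕ.+ q)) - n * ((s * s ^ (1 ℕ.+ q)) * y)) (pos-+ 1 (2 ℕ.+ q)))
    (expand s y (s ^ (1 ℕ.+ q)) ((s + y) ^ (2 ℕ.+ q)) (+ (2 ℕ.+ q)))
    where
    expand : ∀ s y sq syq n → (s + y) * syq - s * (s * sq) - (1ℤ + n) * ((s * sq) * y)
                            ≡ (s + y) * (syq - s * sq - n * (sq * y)) + n * (sq * (y * y))
    expand = solve-∀

  ∣remainder∣≤ : ∀ q s y →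
                 ∣ remainder q s y ∣ ℕ.≤ (2 ℕ.+ q) ℕ.* (2 ℕ.+ q) ℕ.* (∣ y ∣ ℕ.* ∣ y ∣ ℕ.* (∣ s ∣ ℕ.+ ∣ y ∣) ℕ.^ q)
  ∣remainder∣≤ ℕ.zero s y =
    ℕₚ.≤-trans (ℕₚ.≤-reflexive (trans (cong ∣_∣ (remainder-zero s y)) (trans (abs-* y y) (sym (ℕₚ.*-identityʳ _)))))
               (ℕₚ.m≤m+n _ _)
  ∣remainder∣≤ (ℕ.suc q) s y = begin
    ∣ remainder (ℕ.suc q) s y ∣
      ≡⟨ cong ∣_∣ (remainder-suc q s y) ⟩
    ∣ (s + y) * remainder q s y + + (2 ℕ.+ q) * (s ^ (1 ℕ.+ q) * (y * y)) ∣
      ≤⟨ ∣i+j∣≤∣i∣+∣j∣ ((s + y) * remainder q s y) (+ (2 ℕ.+ q) * (s ^ (1 ℕ.+ q) * (y * y))) ⟩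
    ∣ (s + y) * remainder q s y ∣ ℕ.+ ∣ + (2 ℕ.+ q) * (s ^ (1 ℕ.+ q) * (y * y)) ∣
      ≡⟨ cong₂ ℕ._+_ (abs-* (s + y) (remainder q s y))
           (trans (abs-* (+ (2 ℕ.+ q)) (s ^ (1 ℕ.+ q) * (y * y))) (cong (ℕ._*_ (2 ℕ.+ q))
             (trans (abs-* (s ^ (1 ℕ.+ q)) (y * y)) (cong₂ ℕ._*_ (∣i^n∣≡∣i∣^n s (1 ℕ.+ q)) (abs-* y y))))) ⟩
    ∣ s + y ∣ ℕ.* ∣ remainder q s y ∣ ℕ.+ (2 ℕ.+ q) ℕ.* (a ℕ.^ (1 ℕ.+ q) ℕ.* (b ℕ.* b))
      ≤⟨ ℕₚ.+-mono-≤ (ℕₚ.*-mono-≤ (∣i+j∣≤∣i∣+∣j∣ s y) (∣remainder∣≤ q s y))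
           (ℕₚ.*-monoʳ-≤ (2 ℕ.+ q) (ℕₚ.*-monoˡ-≤ (b ℕ.* b) (ℕₚ.^-monoˡ-≤ (1 ℕ.+ q) (ℕₚ.m≤m+n a b)))) ⟩
    (a ℕ.+ b) ℕ.* ((2 ℕ.+ q) ℕ.* (2 ℕ.+ q) ℕ.* (b ℕ.* b ℕ.* (a ℕ.+ b) ℕ.^ q))
      ℕ.+ (2 ℕ.+ q) ℕ.* ((a ℕ.+ b) ℕ.^ (1 ℕ.+ q) ℕ.* (b ℕ.* b))
      ≡⟨ collect (2 ℕ.+ q) (a ℕ.+ b) (b ℕ.* b) ((a ℕ.+ b) ℕ.^ q) ⟩
    ((2 ℕ.+ q) ℕ.* (2 ℕ.+ q) ℕ.+ (2 ℕ.+ q)) ℕ.* (b ℕ.* b ℕ.* (a ℕ.+ b) ℕ.^ (1 ℕ.+ q))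
      ≤⟨ ℕₚ.*-monoˡ-≤ (b ℕ.* b ℕ.* (a ℕ.+ b) ℕ.^ (1 ℕ.+ q))
           (ℕₚ.≤-trans (ℕₚ.m≤n+m _ (3 ℕ.+ q)) (ℕₚ.≤-reflexive (square-suc (2 ℕ.+ q)))) ⟩
    (3 ℕ.+ q) ℕ.* (3 ℕ.+ q) ℕ.* (b ℕ.* b ℕ.* (a ℕ.+ b) ℕ.^ (1 ℕ.+ q)) ∎
    where
    open ℕₚ.≤-Reasoning
    a = ∣ s ∣
    b = ∣ y ∣
    collect : ∀ n c bb p → c ℕ.* (n ℕ.* n ℕ.* (bb ℕ.* p)) ℕ.+ n ℕ.* (c ℕ.* p ℕ.* bb)
                         ≡ (n ℕ.* n ℕ.+ n) ℕ.* (bb ℕ.* (c ℕ.* p))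
    collect = ℕ-Solver.solve-∀
    square-suc : ∀ n → ℕ.suc n ℕ.+ (n ℕ.* n ℕ.+ n) ≡ ℕ.suc n ℕ.* ℕ.suc n
    square-suc = ℕ-Solver.solve-∀

  power-step : ∀ ℓ j (s y : ℤ) → ∣ y ∣ ℕ.≤ ℓ →
    (s + y) ^ twice (ℕ.suc j) ≤ s ^ twice (ℕ.suc j) + + (2 ℕ.+ twice j) * (s ^ (1 ℕ.+ twice j) * y)
                                + + (remainderConstant j ℕ.* (ℓ ℕ.* ℓ)) * (s ^ twice j + + (ℓ ℕ.^ twice j))
  power-step ℓ j s y ∣y∣≤ℓ = begin
    (s + y) ^ (2 ℕ.+ q)
      ≡⟨ split ((s + y) ^ (2 ℕ.+ q)) (s ^ (2 ℕ.+ q)) (+ (2 ℕ.+ q) * (s ^ (1 ℕ.+ q) * y)) ⟩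
    s ^ (2 ℕ.+ q) + + (2 ℕ.+ q) * (s ^ (1 ℕ.+ q) * y) + remainder q s y
      ≤⟨ +-monoʳ-≤ (s ^ (2 ℕ.+ q) + + (2 ℕ.+ q) * (s ^ (1 ℕ.+ q) * y))
                   (≤-trans (i≤+∣i∣ (remainder q s y)) (+≤+ ∣R∣≤)) ⟩
    s ^ (2 ℕ.+ q) + + (2 ℕ.+ q) * (s ^ (1 ℕ.+ q) * y) + + (c ℕ.* (∣ s ∣ ℕ.^ q ℕ.+ ℓ ℕ.^ q))
      ≡⟨ cong (_+_ (s ^ (2 ℕ.+ q) + + (2 ℕ.+ q) * (s ^ (1 ℕ.+ q) * y)))
           (trans (pos-* c _) (cong (_*_ (+ c)) (trans (pos-+ (∣ s ∣ ℕ.^ q) (ℓ ℕ.^ q))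
             (cong (_+ + (ℓ ℕ.^ q)) (sym (i^[twice-n]≡+∣i∣^[twice-n] s j)))))) ⟩
    s ^ (2 ℕ.+ q) + + (2 ℕ.+ q) * (s ^ (1 ℕ.+ q) * y) + + c * (s ^ q + + (ℓ ℕ.^ q)) ∎
    where
    open ≤-Reasoning
    q = twice j
    c = remainderConstant j ℕ.* (ℓ ℕ.* ℓ)
    split : ∀ x a b → x ≡ a + b + (x - a - b)
    split = solve-∀
    reorder : ∀ n ll t u → n ℕ.* n ℕ.* (ll ℕ.* (t ℕ.* u)) ≡ n ℕ.* n ℕ.* t ℕ.* ll ℕ.* u
    reorder = ℕ-Solver.solve-∀
    ∣R∣≤ : ∣ remainder q s y ∣ ℕ.≤ c ℕ.* (∣ s ∣ ℕ.^ q ℕ.+ ℓ ℕ.^ q)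
    ∣R∣≤ = ℕₚ.≤-trans (∣remainder∣≤ q s y)
           (ℕₚ.≤-trans (ℕₚ.*-monoʳ-≤ ((2 ℕ.+ q) ℕ.* (2 ℕ.+ q))
              (ℕₚ.*-mono-≤ (ℕₚ.*-mono-≤ ∣y∣≤ℓ ∣y∣≤ℓ)
                (ℕₚ.≤-trans (ℕₚ.^-monoˡ-≤ q (ℕₚ.+-monoʳ-≤ ∣ s ∣ ∣y∣≤ℓ)) ([m+n]^o≤2^o*[m^o+n^o] ∣ s ∣ ℓ q))))
           (ℕₚ.≤-reflexive (reorder (2 ℕ.+ q) (ℓ ℕ.* ℓ) (2 ℕ.^ q) (∣ s ∣ ℕ.^ q ℕ.+ ℓ ℕ.^ q))))

  -- Moments of sums of centred hit indicators

  centredHit : (L : ℕ.ℕ) → Bool → Fin L → Fin L → ℤ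
  centredHit L marked a t = + L * 𝟙 (marked ∧ (a =ᶠ t)) - 𝟙 marked

  centredHit-unmarked : ∀ {L} (a t : Fin L) → centredHit L false a t ≡ 0ℤ
  centredHit-unmarked {L} a t = trans (+-identityʳ (+ L * 0ℤ)) (*-zeroʳ (+ L))

  ∣centredHit∣≤ : ∀ {L} → 1 ℕ.≤ L → ∀ b (a t : Fin L) → ∣ centredHit L b a t ∣ ℕ.≤ L
  ∣centredHit∣≤ L≥1 false a t = ℕₚ.≤-trans (ℕₚ.≤-reflexive (cong ∣_∣ (centredHit-unmarked a t))) ℕ.z≤n
  ∣centredHit∣≤ {L} L≥1 true a t with a =ᶠ t
  ... | true  = ℕₚ.≤-trans (ℕₚ.≤-reflexive (cong ∣_∣ (trans (cong (_- 1ℤ) (*-identityʳ (+ L)))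
                  (trans (m-n≡m⊖n L 1) (⊖-≥ L≥1))))) (ℕₚ.m∸n≤m L 1)
  ... | false = ℕₚ.≤-trans (ℕₚ.≤-reflexive (cong ∣_∣ (cong (_- 1ℤ) (*-zeroʳ (+ L))))) L≥1

  ∑-centredHit : ∀ {L} b → T b → (t : Fin L) → ∑[ a < L ] centredHit L b a t ≡ 0ℤ
  ∑-centredHit     false () t
  ∑-centredHit {L} true  _  t = begin
    ∑[ a < L ] (+ L * 𝟙 (a =ᶠ t) - 1ℤ)            ≡⟨ sum-sub (λ a → + L * 𝟙 (a =ᶠ t)) (λ _ → 1ℤ) ⟩
    ∑[ a < L ] (+ L * 𝟙 (a =ᶠ t)) - ∑[ a < L ] 1ℤ ≡⟨ cong₂ _-_ (trans (sym (*-distribˡ-sum (+ L) (λ a → 𝟙 (a =ᶠ t))))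
                                                                   (cong (_*_ (+ L)) hits-once))
                                                            (sum-const {L} 1ℤ) ⟩
    + L * 1ℤ - + L * 1ℤ                          ≡⟨ +-inverseʳ (+ L * 1ℤ) ⟩
    0ℤ                                            ∎
    where
    open ≡-Reasoning
    hits-once : ∑[ a < L ] 𝟙 (a =ᶠ t) ≡ 1ℤ
    hits-once = trans (sum-cong-≗ (λ a → trans (cong 𝟙 (=ᶠ-sym a t)) (sym (*-identityʳ _)))) (sum-δ t (λ _ → 1ℤ))

  module Moments {K N L : ℕ.ℕ} (H : Fin K → Fin N → Fin L) (marked : Fin N → Bool) (target : Fin K → Fin L)
                 (L≥1 : 1 ℕ.≤ L) where

    Y : Fin K → Fin N → ℤ
    Y i x = centredHit L (marked x) (H i x) (target i)

    Orthogonal : ℕ.ℕ → Set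
    Orthogonal q = (t : Vec (Fin N) q) (w : Fin N) → T (marked w) → w ∉ t →
                   ∑[ i < K ] (Y i w * ∏ (map (Y i) t)) ≡ 0ℤ

    S : ∀ {r} → (Fin r → Fin N) → Fin K → ℤ
    S {r} g i = ∑[ k < r ] Y i (g k)

    M : ℕ.ℕ → ∀ {r} → (Fin r → Fin N) → ℤ
    M j g = ∑[ i < K ] (S g i ^ twice j)

    ∑-S^q*Y≡0 : ∀ {q} → Orthogonal q → ∀ {r} (g : Fin r → Fin N) (w : Fin N) → T (marked w) → (∀ k → ¬ g k ≡ w) →
                ∑[ i < K ] (S g i ^ q * Y i w) ≡ 0ℤ
    ∑-S^q*Y≡0 {q} orthogonal g w marked-w g≢w = begin
      ∑[ i < K ] (S g i ^ q * Y i w)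
        ≡⟨ sum-cong-≗ (λ i → trans (*-comm (S g i ^ q) (Y i w)) (trans (cong (_*_ (Y i w)) (sum^≡∑ᵛ∏ q (Y i ∘ g)))
                                (*-distribˡ-∑ᵛ q (Y i w) (λ t → ∏ (map (Y i ∘ g) t))))) ⟩
      ∑[ i < K ] ∑ᵛ q (λ t → Y i w * ∏ (map (Y i ∘ g) t))
        ≡⟨ ∑-∑ᵛ-comm q (λ i t → Y i w * ∏ (map (Y i ∘ g) t)) ⟩
      ∑ᵛ q (λ t → ∑[ i < K ] (Y i w * ∏ (map (Y i ∘ g) t)))
        ≡⟨ ∑ᵛ-cong q (λ t → trans (sum-cong-≗ (λ i → cong (λ v → Y i w * ∏ v) (map-∘ (Y i) g t)))
                                  (orthogonal (map g t) w marked-w (w∉ t))) ⟩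
      ∑ᵛ q (λ _ → 0ℤ)
        ≡⟨ ∑ᵛ-zero q ⟩
      0ℤ ∎
      where
      open ≡-Reasoning
      w∉ : ∀ t → w ∉ map g t
      w∉ t w∈ = g≢w (lookup t (index w∈)) (sym (trans (lookup-index w∈) (lookup-map (index w∈) g t)))

    moment-step : ∀ j → Orthogonal (ℕ.suc (twice j)) → ∀ {r} (g : Fin (ℕ.suc r) → Fin N) → Injective _≡_ _≡_ g →
                  T (marked (g zero)) →
                  M (ℕ.suc j) g ≤ M (ℕ.suc j) (g ∘ suc)
                                  + + (remainderConstant j ℕ.* (L ℕ.* L)) * (M j (g ∘ suc) + + K * + (L ℕ.^ twice j))
    moment-step j orthogonal g g-inj marked-head = begin
      ∑[ i < K ] ((Y i w + S g′ i) ^ (2 ℕ.+ q))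
        ≡⟨ sum-cong-≗ (λ i → cong (_^ (2 ℕ.+ q)) (+-comm (Y i w) (S g′ i))) ⟩
      ∑[ i < K ] ((S g′ i + Y i w) ^ (2 ℕ.+ q))
        ≤⟨ sum-mono-≤ (λ i → power-step L j (S g′ i) (Y i w) (∣centredHit∣≤ L≥1 (marked w) (H i w) (target i))) ⟩
      ∑[ i < K ] (S g′ i ^ (2 ℕ.+ q) + + (2 ℕ.+ q) * (S g′ i ^ (1 ℕ.+ q) * Y i w) + + c * (S g′ i ^ q + + (L ℕ.^ q)))
        ≡⟨ trans (∑-distrib-+ (λ i → S g′ i ^ (2 ℕ.+ q) + + (2 ℕ.+ q) * (S g′ i ^ (1 ℕ.+ q) * Y i w))
                              (λ i → + c * (S g′ i ^ q + + (L ℕ.^ q))))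
                 (cong₂ _+_ (∑-distrib-+ (λ i → S g′ i ^ (2 ℕ.+ q)) (λ i → + (2 ℕ.+ q) * (S g′ i ^ (1 ℕ.+ q) * Y i w)))
                            (sym (*-distribˡ-sum (+ c) (λ i → S g′ i ^ q + + (L ℕ.^ q))))) ⟩
      M (ℕ.suc j) g′ + ∑[ i < K ] (+ (2 ℕ.+ q) * (S g′ i ^ (1 ℕ.+ q) * Y i w))
                     + + c * ∑[ i < K ] (S g′ i ^ q + + (L ℕ.^ q))
        ≡⟨ cong₂ (λ u v → M (ℕ.suc j) g′ + u + + c * v) cross-term-vanishes
                 (trans (∑-distrib-+ (λ i → S g′ i ^ q) (λ _ → + (L ℕ.^ q)))
                        (cong (_+_ (M j g′)) (sum-const {K} (+ (L ℕ.^ q))))) ⟩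
      M (ℕ.suc j) g′ + 0ℤ + + c * (M j g′ + + K * + (L ℕ.^ q))
        ≡⟨ cong (_+ + c * (M j g′ + + K * + (L ℕ.^ q))) (+-identityʳ (M (ℕ.suc j) g′)) ⟩
      M (ℕ.suc j) g′ + + c * (M j g′ + + K * + (L ℕ.^ q)) ∎
      where
      open ≤-Reasoning
      q = twice j
      c = remainderConstant j ℕ.* (L ℕ.* L)
      w = g zero
      g′ = g ∘ suc
      cross-term-vanishes : ∑[ i < K ] (+ (2 ℕ.+ q) * (S g′ i ^ (1 ℕ.+ q) * Y i w)) ≡ 0ℤ
      cross-term-vanishes = trans (sym (*-distribˡ-sum (+ (2 ℕ.+ q)) (λ i → S g′ i ^ (1 ℕ.+ q) * Y i w)))
        (trans (cong (_*_ (+ (2 ℕ.+ q)))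
                     (∑-S^q*Y≡0 orthogonal g′ w marked-head (λ k g′k≡w → Finₚ.0≢1+n (g-inj (sym g′k≡w)))))
               (*-zeroʳ (+ (2 ℕ.+ q))))

    moment-bound : ∀ j → (∀ {q} → q ℕ.< twice j → Orthogonal q) → ∀ {r} (g : Fin r → Fin N) → Injective _≡_ _≡_ g →
                   M j g ≤ + momentBound K L j (count (marked ∘ g))
    moment-bound ℕ.zero _ g _ = ≤-reflexive (trans (sum-const {K} 1ℤ) (trans (*-identityʳ (+ K))
      (cong +_ (sym (trans (ℕₚ.*-identityʳ _) (trans (ℕₚ.*-identityʳ _) (ℕₚ.*-identityʳ K)))))))
    moment-bound (ℕ.suc j) orthogonal {ℕ.zero}  g _ = ≤-trans (≤-reflexive (sum-zero {K} (λ _ → refl))) (+≤+ ℕ.z≤n)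
    moment-bound (ℕ.suc j) orthogonal {ℕ.suc r} g g-inj = by-head (marked (g zero)) refl
      where
      g′ = g ∘ suc
      g′-inj : Injective _≡_ _≡_ g′
      g′-inj = Finₚ.suc-injective ∘ g-inj
      D′ = count (marked ∘ g′)
      l = L ℕ.^ twice j
      c = remainderConstant j ℕ.* (L ℕ.* L)
      by-head : ∀ b → marked (g zero) ≡ b →
                M (ℕ.suc j) g ≤ + momentBound K L (ℕ.suc j) ((if b then 1 else 0) ℕ.+ D′)
      by-head false unmarked-head = ≤-trans
        (≤-reflexive (sum-cong-≗ (λ i → cong (_^ twice (ℕ.suc j))
          (trans (cong (λ b → centredHit L b (H i (g zero)) (target i) + S g′ i) unmarked-head)
                 (trans (cong (_+ S g′ i) (centredHit-unmarked (H i (g zero)) (target i))) (+-identityˡ (S g′ i)))))))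
        (moment-bound (ℕ.suc j) orthogonal g′ g′-inj)
      by-head true marked-head = begin
        M (ℕ.suc j) g
          ≤⟨ moment-step j (orthogonal (ℕₚ.n<1+n _)) g g-inj (subst T (sym marked-head) _) ⟩
        M (ℕ.suc j) g′ + + c * (M j g′ + + K * + l)
          ≤⟨ +-mono-≤ (moment-bound (ℕ.suc j) orthogonal g′ g′-inj)
                      (*-monoˡ-≤-nonNeg (+ c) (+-monoˡ-≤ (+ K * + l)
                        (moment-bound j (λ q<2j → orthogonal (ℕₚ.m<n⇒m<1+n (ℕₚ.m<n⇒m<1+n q<2j))) g′ g′-inj))) ⟩
        + momentBound K L (ℕ.suc j) D′ + + c * (+ momentBound K L j D′ + + K * + l)
          ≡⟨ to-ℕ (momentBound K L (ℕ.suc j) D′) c (momentBound K L j D′) K l ⟩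
        + (momentBound K L (ℕ.suc j) D′ ℕ.+ c ℕ.* (momentBound K L j D′ ℕ.+ K ℕ.* l))
          ≤⟨ +≤+ (momentBound-step K L j D′) ⟩
        + momentBound K L (ℕ.suc j) (ℕ.suc D′) ∎
        where
        open ≤-Reasoning
        to-ℕ : ∀ a c b k l → + a + + c * (+ b + + k * + l) ≡ + (a ℕ.+ c ℕ.* (b ℕ.+ k ℕ.* l))
        to-ℕ a c b k l = sym (trans (pos-+ a _) (cong (_+_ (+ a)) (trans (pos-* c _)
                           (cong (_*_ (+ c)) (trans (pos-+ b _) (cong (_+_ (+ b)) (pos-* k l)))))))

    moment-tail : ∀ j → (∀ {q} → q ℕ.< twice j → Orthogonal q) → (B : Fin K → Bool) (a t : ℕ.ℕ) →
                  (∀ i → T (B i) → t ℕ.≤ a ℕ.* ∣ S id i ∣) →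
                  count B ℕ.* t ℕ.^ twice j ℕ.≤ a ℕ.^ twice j ℕ.* momentBound K L j (count marked)
    moment-tail j orthogonal B a t far = drop‿+≤+ (begin
      + (count B ℕ.* t ℕ.^ q)                ≡⟨ pos-* (count B) (t ℕ.^ q) ⟩
      + count B * + (t ℕ.^ q)                ≤⟨ markov B F (+ (t ℕ.^ q)) F≥0 far′ ⟩
      ∑[ i < K ] F i                          ≡⟨ *-distribˡ-sum (+ (a ℕ.^ q)) (λ i → S id i ^ q) ⟨
      + (a ℕ.^ q) * M j id                   ≤⟨ *-monoˡ-≤-nonNeg (+ (a ℕ.^ q)) (moment-bound j orthogonal id id) ⟩
      + (a ℕ.^ q) * + momentBound K L j (count marked)
                                              ≡⟨ pos-* (a ℕ.^ q) _ ⟨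
      + (a ℕ.^ q ℕ.* momentBound K L j (count marked)) ∎)
      where
      open ≤-Reasoning
      q = twice j
      F : Fin K → ℤ
      F i = + (a ℕ.^ q) * S id i ^ q
      F≡ : ∀ i → F i ≡ + ((a ℕ.* ∣ S id i ∣) ℕ.^ q)
      F≡ i = trans (cong (_*_ (+ (a ℕ.^ q))) (i^[twice-n]≡+∣i∣^[twice-n] (S id i) j))
                   (trans (sym (pos-* (a ℕ.^ q) _)) (cong +_ (sym (^-distribʳ-* a ∣ S id i ∣ q))))
      F≥0 : ∀ i → 0ℤ ≤ F i
      F≥0 i = subst (0ℤ ≤_) (sym (F≡ i)) (+≤+ ℕ.z≤n)
      far′ : ∀ i → T (B i) → + (t ℕ.^ q) ≤ F i
      far′ i Bi = subst (+ (t ℕ.^ q) ≤_) (sym (F≡ i)) (+≤+ (ℕₚ.^-monoˡ-≤ q (far i Bi)))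

    ∣S-id∣≡ : ∀ i → ∣ S id i ∣ ≡ ℕ.∣ L ℕ.* count (λ x → marked x ∧ (H i x =ᶠ target i)) - count marked ∣
    ∣S-id∣≡ i = trans (cong ∣_∣ closed-form) (∣+m-+n∣≡∣m-n∣ _ (count marked))
      where
      closed-form : S id i ≡ + (L ℕ.* count (λ x → marked x ∧ (H i x =ᶠ target i))) - + count marked
      closed-form = trans (sum-sub (λ x → + L * 𝟙 (marked x ∧ (H i x =ᶠ target i))) (𝟙 ∘ marked))
        (cong₂ _-_ (trans (sym (*-distribˡ-sum (+ L) (λ x → 𝟙 (marked x ∧ (H i x =ᶠ target i)))))
                          (trans (cong (_*_ (+ L)) (sum-𝟙 (λ x → marked x ∧ (H i x =ᶠ target i)))) (sym (pos-* L _))))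
                   (sum-𝟙 marked))

  module _ {K N L c : ℕ.ℕ} (H : Fin K → Fin N → Fin L) (indep : CWiseIndependent c K N L H)
           (c≤N : c ℕ.≤ N) (L≥1 : 1 ℕ.≤ L) (marked : Fin N → Bool) where

    open Independent H indep using (∑-family-centred)

    centredProduct : ∀ {q} → Vec (Fin N) q → Vec (Fin L) q → Fin L → ℤ
    centredProduct []      []       b = 1ℤ
    centredProduct (x ∷ t) (y ∷ ys) b = centredHit L (marked x) y b * centredProduct t ys b

    centred-factor : (w : Fin N) → T (marked w) → ∀ {q} (t : Vec (Fin N) q) (b : Fin L) (ys : Vec (Fin L) q) →
                     ∑[ a < L ] (centredHit L (marked w) a b * centredProduct t ys b) ≡ 0ℤ
    centred-factor w marked-w t b ys =
      trans (sym (*-distribʳ-sum (centredProduct t ys b) (λ a → centredHit L (marked w) a b)))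
            (trans (cong (_* centredProduct t ys b) (∑-centredHit (marked w) marked-w b)) (*-zeroˡ (centredProduct t ys b)))

    module _ (target : Fin K → Fin L) where

      open Moments H marked target L≥1 using (Y)

      ∏-map-Y : ∀ {q} i (t : Vec (Fin N) q) → ∏ (map (Y i) t) ≡ centredProduct t (map (H i) t) (target i)
      ∏-map-Y i []      = refl
      ∏-map-Y i (x ∷ t) = cong (_*_ (Y i x)) (∏-map-Y i t)

    orthogonal-fixed : (b : Fin L) → ∀ {q} → q ℕ.< c → Moments.Orthogonal H marked (λ _ → b) L≥1 q
    orthogonal-fixed b q<c t w marked-w w∉t =
      trans (sum-cong-≗ (λ i → cong (_*_ (centredHit L (marked w) (H i w) b)) (∏-map-Y (λ _ → b) i t)))
            (∑-family-centred c≤N L≥1 w t q<c w∉t (λ a ys → centredHit L (marked w) a b * centredProduct t ys b)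
                              (centred-factor w marked-w t b))

    orthogonal-anchored : (v : Fin N) → marked v ≡ false → ∀ {q} → ℕ.suc q ℕ.< c →
                          Moments.Orthogonal H marked (λ i → H i v) L≥1 q
    orthogonal-anchored v unmarked-v {q} q+1<c t w marked-w w∉t =
      trans (sum-cong-≗ (λ i → cong (_*_ (centredHit L (marked w) (H i w) (H i v))) (∏-map-Y (λ i → H i v) i t)))
            (∑-family-centred c≤N L≥1 w (v ∷ t) q+1<c w∉v∷t Φ Φ-centred)
      where
      Φ : Fin L → Vec (Fin L) (ℕ.suc q) → ℤ
      Φ a (b ∷ ys) = centredHit L (marked w) a b * centredProduct t ys b
      Φ-centred : ∀ ys → ∑[ a < L ] Φ a ys ≡ 0ℤ
      Φ-centred (b ∷ ys) = centred-factor w marked-w t b ys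
      w∉v∷t : w ∉ v ∷ t
      w∉v∷t (here w≡v)   = subst T (trans (cong marked w≡v) unmarked-v) marked-w
      w∉v∷t (there w∈t) = w∉t w∈t

  degree-tail : ∀ {n K c} (m : ℕ.ℕ) (adj : Fin n → Fin n → Bool) (v : Fin n) (H₁ : Fin K → Fin n → Fin m) →
                CWiseIndependent c K n m H₁ → c ℕ.≤ n → 33 ℕ.≤ c → 1 ℕ.≤ m → adj v v ≡ false →
                count (λ i → not (degOK m (deg adj v) (deg' adj (H₁ i) v))) ℕ.* (m ℕ.^ 7) ℕ.^ 32
                  ℕ.≤ momentBound K m 16 (deg adj v)
  degree-tail m adj v H₁ indep c≤n 33≤c m≥1 no-loop = ℕₚ.≤-trans
    (moment-tail 16 (λ q<32 → orthogonal-anchored H₁ indep c≤n m≥1 (adj v) v no-loop (ℕₚ.≤-trans (ℕ.s≤s q<32) 33≤c))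
                 (λ i → not (degOK m (deg adj v) (deg' adj (H₁ i) v))) 1 (m ℕ.^ 7) far)
    (ℕₚ.≤-reflexive (ℕₚ.*-identityˡ _))
    where
    open Moments H₁ (adj v) (λ i → H₁ i v) m≥1 using (S; ∣S-id∣≡; moment-tail)
    far : ∀ i → T (not (degOK m (deg adj v) (deg' adj (H₁ i) v))) → m ℕ.^ 7 ℕ.≤ 1 ℕ.* ∣ S id i ∣
    far i bad = subst (m ℕ.^ 7 ℕ.≤_) (sym (trans (ℕₚ.*-identityˡ _) (∣S-id∣≡ i)))
                      (degree-deviation m (deg adj v) (deg' adj (H₁ i) v) bad)

  palette-tail : ∀ {n K c} (m : ℕ.ℕ) (pal : Fin n → Fin (n ℕ.^ 2) → Bool) (v : Fin n) (h₁ : Fin n → Fin m)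
                 (H₂ : Fin K → Fin (n ℕ.^ 2) → Fin (m ℕ.∸ 1)) →
                 CWiseIndependent c K (n ℕ.^ 2) (m ℕ.∸ 1) H₂ → c ℕ.≤ n ℕ.^ 2 → 33 ℕ.≤ c → 2 ℕ.≤ m →
                 m ℕ.^ 10 ℕ.< palSize pal v → toℕ (h₁ v) ℕ.< m ℕ.∸ 1 →
                 count (λ j → not (palOK m (palSize pal v) (pal' pal h₁ (H₂ j) v))) ℕ.* palSize pal v ℕ.^ 32
                   ℕ.≤ (2 ℕ.* m) ℕ.^ 32 ℕ.* momentBound K (m ℕ.∸ 1) 16 (palSize pal v)
  palette-tail m pal v h₁ H₂ indep c≤n² 33≤c m≥2 m¹⁰<p h₁v<m-1 =
    moment-tail 16 (λ q<32 → orthogonal-fixed H₂ indep c≤n² m-1≥1 (pal v) slot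
                               (ℕₚ.≤-trans (ℕₚ.m≤n⇒m≤1+n q<32) 33≤c))
                (λ j → not (palOK m p (pal' pal h₁ (H₂ j) v))) (2 ℕ.* m) p far
    where
    p = palSize pal v
    m-1≥1 : 1 ℕ.≤ m ℕ.∸ 1
    m-1≥1 = ℕₚ.∸-monoˡ-≤ 1 m≥2
    slot : Fin (m ℕ.∸ 1)
    slot = fromℕ< h₁v<m-1
    open Moments H₂ (pal v) (λ _ → slot) m-1≥1 using (S; ∣S-id∣≡; moment-tail)
    far : ∀ j → T (not (palOK m p (pal' pal h₁ (H₂ j) v))) → p ℕ.≤ 2 ℕ.* m ℕ.* ∣ S id j ∣
    far j bad = subst (λ x → p ℕ.≤ 2 ℕ.* m ℕ.* x)
      (sym (trans (∣S-id∣≡ j) (cong (λ x → ℕ.∣ (m ℕ.∸ 1) ℕ.* x - p ∣)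
        (count-cong (λ γ → cong (pal v γ ∧_) (=ᶠ-fromℕ< (H₂ j γ) h₁v<m-1))))))
      (palette-deviation m p (pal' pal h₁ (H₂ j) v) (ℕₚ.≤-trans (ℕ.s≤s ℕ.z≤n) m≥2) m¹⁰<p bad)

open Arithmetic using (momentConstant; degree-threshold; palette-threshold; m*o≤n*p⇒p*q≤o⇒m*q≤n; m^10<p≤n^2⇒m≤n)
open MomentMethod using (degree-tail; palette-tail)
open import Data.Nat using (ℕ; _+_; _*_; _∸_; _^_; _≤_; _<_; _≤ᵇ_; z≤n; s≤s; >-nonZero)
open import Data.Nat.Properties
open import Data.Nat.Tactic.RingSolver using (solve-∀)

-- Union bound over the two ways of being bad

count≤ : ∀ {k} (P : Fin k → Bool) → count P ≤ k
count≤ {ℕ.zero}  P = z≤n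
count≤ {ℕ.suc k} P with P zero
... | true  = s≤s (count≤ (P ∘ suc))
... | false = m≤n⇒m≤1+n (count≤ (P ∘ suc))

count-false : ∀ k → count {k} (λ _ → false) ≡ 0
count-false ℕ.zero    = refl
count-false (ℕ.suc k) = count-false k

count-const : ∀ {k} (b : Bool) → count {k} (λ _ → b) ≡ (if b then k else 0)
count-const {ℕ.zero}  true  = refl
count-const {ℕ.suc k} true  = cong ℕ.suc (count-const {k} true)
count-const {k}       false = count-false k

count-≤-+ : ∀ {k} (P Q R : Fin k → Bool) → (∀ i → T (P i) → T (Q i) ⊎ T (R i)) → count P ≤ count Q + count R
count-≤-+ {ℕ.zero}  P Q R P⇒Q∨R = z≤n
count-≤-+ {ℕ.suc k} P Q R P⇒Q∨R = begin
  bit (P zero) + count (P ∘ suc)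
    ≤⟨ +-mono-≤ head (count-≤-+ (P ∘ suc) (Q ∘ suc) (R ∘ suc) (P⇒Q∨R ∘ suc)) ⟩
  bit (Q zero) + bit (R zero) + (count (Q ∘ suc) + count (R ∘ suc))
    ≡⟨ interchange (bit (Q zero)) (bit (R zero)) (count (Q ∘ suc)) (count (R ∘ suc)) ⟩
  bit (Q zero) + count (Q ∘ suc) + (bit (R zero) + count (R ∘ suc)) ∎
  where
  open ≤-Reasoning
  bit : Bool → ℕ
  bit b = if b then 1 else 0
  interchange : ∀ a b c d → a + b + (c + d) ≡ a + c + (b + d)
  interchange = solve-∀
  head : bit (P zero) ≤ bit (Q zero) + bit (R zero)
  head with P zero | Q zero | R zero | P⇒Q∨R zero
  ... | false | _     | _     | _         = z≤n
  ... | true  | true  | _     | _         = s≤s z≤n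
  ... | true  | false | true  | _         = s≤s z≤n
  ... | true  | false | false | P0⇒Q0∨R0 with P0⇒Q0∨R0 _
  ...   | inj₁ ()
  ...   | inj₂ ()

sumF-mono-≤ : ∀ {k} {f g : Fin k → ℕ} → (∀ i → f i ≤ g i) → sumF f ≤ sumF g
sumF-mono-≤ {ℕ.zero}  f≤g = z≤n
sumF-mono-≤ {ℕ.suc k} f≤g = +-mono-≤ (f≤g zero) (sumF-mono-≤ (f≤g ∘ suc))

sumF-+ : ∀ {k} (f g : Fin k → ℕ) → sumF (λ i → f i + g i) ≡ sumF f + sumF g
sumF-+ {ℕ.zero}  f g = refl
sumF-+ {ℕ.suc k} f g = trans (cong (f zero + g zero +_) (sumF-+ (f ∘ suc) (g ∘ suc))) (interchange (f zero) (g zero) _ _)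
  where
  interchange : ∀ a b c d → a + b + (c + d) ≡ a + c + (b + d)
  interchange = solve-∀

sumF-count-const : ∀ {k} l (P : Fin k → Bool) → sumF (λ i → count {l} (λ _ → P i)) ≡ count P * l
sumF-count-const {ℕ.zero}  l P = refl
sumF-count-const {ℕ.suc k} l P with P zero
... | true  = cong₂ _+_ (count-const {l} true) (sumF-count-const l (P ∘ suc))
... | false = trans (cong₂ _+_ (count-false l) refl) (sumF-count-const l (P ∘ suc))

sumF-*-≤ : ∀ {k} (f : Fin k → ℕ) (t b : ℕ) → (∀ i → f i * t ≤ b) → sumF f * t ≤ k * b
sumF-*-≤ {ℕ.zero}  f t b ft≤b = z≤n
sumF-*-≤ {ℕ.suc k} f t b ft≤b =
  ≤-trans (≤-reflexive (*-distribʳ-+ t (f zero) (sumF (f ∘ suc))))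
          (+-mono-≤ (ft≤b zero) (sumF-*-≤ (f ∘ suc) t b (ft≤b ∘ suc)))

degree-count-bound : ∀ {n K c} (m : ℕ) (adj : Fin n → Fin n → Bool) (v : Fin n) (H₁ : Fin K → Fin n → Fin m) →
  CWiseIndependent c K n m H₁ → c ≤ n → 33 ≤ c → 2 ≤ m → momentConstant 16 * 2 ^ 16 ≤ m →
  adj v v ≡ false → deg adj v ≤ m ^ 10 + m ^ 7 →
  count (λ i → not (degOK m (deg adj v) (deg' adj (H₁ i) v))) * m ^ 30 ≤ K
degree-count-bound {K = K} m adj v H₁ indep c≤n 33≤c m≥2 γ2¹⁶≤m no-loop d≤ =
  m*o≤n*p⇒p*q≤o⇒m*q≤n (count (λ i → not (degOK m d (deg' adj (H₁ i) v)))) K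
                      ((m ^ 7) ^ 32) (γ * m ^ 32 * ℕ.suc d ^ 16) (m ^ 30)
    (m^n>0 (m ^ 7) {{m^n≢0 m 7 {{m≢0}}}} 32)
    (≤-trans (degree-tail m adj v H₁ indep c≤n 33≤c (≤-trans (s≤s z≤n) m≥2) no-loop)
             (≤-reflexive (regroup K γ (m ^ 32) (ℕ.suc d ^ 16))))
    (degree-threshold γ m d m≥2 γ2¹⁶≤m d≤)
  where
  γ = momentConstant 16
  d = deg adj v
  m≢0 = >-nonZero (≤-trans (s≤s z≤n) m≥2)
  regroup : ∀ K g l s → K * g * l * s ≡ K * (g * l * s)
  regroup = solve-∀

palette-count-bound : ∀ {n K c} (m : ℕ) (pal : Fin n → Fin (n ^ 2) → Bool) (v : Fin n) (h₁ : Fin n → Fin m)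
  (H₂ : Fin K → Fin (n ^ 2) → Fin (m ∸ 1)) →
  CWiseIndependent c K (n ^ 2) (m ∸ 1) H₂ → c ≤ n ^ 2 → 33 ≤ c → 2 ≤ m → momentConstant 16 * 2 ^ 48 ≤ m →
  m ^ 10 < palSize pal v → toℕ (h₁ v) < m ∸ 1 →
  count (λ j → not (palOK m (palSize pal v) (pal' pal h₁ (H₂ j) v))) * m ^ 30 ≤ K
palette-count-bound {K = K} m pal v h₁ H₂ indep c≤n² 33≤c m≥2 γ2⁴⁸≤m m¹⁰<p h₁v<m-1 =
  m*o≤n*p⇒p*q≤o⇒m*q≤n (count (λ j → not (palOK m p (pal' pal h₁ (H₂ j) v)))) K
                      (p ^ 32) ((2 * m) ^ 32 * (γ * (m ∸ 1) ^ 32 * ℕ.suc p ^ 16)) (m ^ 30)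
    (m^n>0 p {{>-nonZero (≤-<-trans z≤n m¹⁰<p)}} 32)
    (≤-trans (palette-tail m pal v h₁ H₂ indep c≤n² 33≤c m≥2 m¹⁰<p h₁v<m-1)
             (≤-reflexive (regroup ((2 * m) ^ 32) K γ ((m ∸ 1) ^ 32) (ℕ.suc p ^ 16))))
    (palette-threshold γ m p (≤-trans (s≤s z≤n) m≥2) γ2⁴⁸≤m m¹⁰<p)
  where
  γ = momentConstant 16
  p = palSize pal v
  regroup : ∀ a K g l s → a * (K * g * l * s) ≡ K * (a * (g * l * s))
  regroup = solve-∀

bad⇒degree-or-palette : ∀ b x y → T (not (if b then x ∧ y else x)) → T (not x) ⊎ T (b ∧ not y)
bad⇒degree-or-palette true  true  true  ()
bad⇒degree-or-palette true  true  false _ = inj₂ _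
bad⇒degree-or-palette true  false _     _ = inj₁ _
bad⇒degree-or-palette false true  _     ()
bad⇒degree-or-palette false false _     _ = inj₁ _

bad-count-bound : ∀ {n K₁ K₂ c} (m : ℕ) (adj : Fin n → Fin n → Bool) (pal : Fin n → Fin (n ^ 2) → Bool)
  (H₁ : Fin K₁ → Fin n → Fin m) (H₂ : Fin K₂ → Fin (n ^ 2) → Fin (m ∸ 1)) (v : Fin n) →
  CWiseIndependent c K₁ n m H₁ → CWiseIndependent c K₂ (n ^ 2) (m ∸ 1) H₂ →
  33 ≤ c → c ≤ n → 2 ≤ m → momentConstant 16 * 2 ^ 48 ≤ m →
  adj v v ≡ false → m ^ 10 < palSize pal v → deg adj v ≤ m ^ 10 + m ^ 7 →
  countBad adj pal H₁ H₂ v * m ^ 30 ≤ 2 * (K₁ * K₂)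
bad-count-bound {n} {K₁} {K₂} m adj pal H₁ H₂ v indep₁ indep₂ 33≤c c≤n m≥2 γ2⁴⁸≤m no-loop m¹⁰<p d≤ = begin
  countBad adj pal H₁ H₂ v * m ^ 30
    ≤⟨ *-monoˡ-≤ (m ^ 30) (sumF-mono-≤ (λ i → count-≤-+ _ (λ _ → degree-bad i) (palette-bad i)
         (λ j → bad⇒degree-or-palette (slot-free i) (degOK m (deg adj v) (deg' adj (H₁ i) v))
                                                    (palOK m p (pal' pal (H₁ i) (H₂ j) v))))) ⟩
  sumF (λ i → count {K₂} (λ _ → degree-bad i) + count (palette-bad i)) * m ^ 30
    ≡⟨ trans (cong (_* m ^ 30) (sumF-+ (λ i → count {K₂} (λ _ → degree-bad i)) (λ i → count (palette-bad i))))
             (*-distribʳ-+ (m ^ 30) (sumF (λ i → count {K₂} (λ _ → degree-bad i))) (sumF (λ i → count (palette-bad i)))) ⟩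
  sumF (λ i → count {K₂} (λ _ → degree-bad i)) * m ^ 30 + sumF (λ i → count (palette-bad i)) * m ^ 30
    ≤⟨ +-mono-≤ degree-part (sumF-*-≤ (λ i → count (palette-bad i)) (m ^ 30) K₂ palette-row) ⟩
  K₁ * K₂ + K₁ * K₂
    ≡⟨ cong (K₁ * K₂ +_) (+-identityʳ (K₁ * K₂)) ⟨
  2 * (K₁ * K₂) ∎
  where
  open ≤-Reasoning
  p = palSize pal v
  degree-bad : Fin K₁ → Bool
  degree-bad i = not (degOK m (deg adj v) (deg' adj (H₁ i) v))
  slot-free : Fin K₁ → Bool
  slot-free i = ℕ.suc (toℕ (H₁ i v)) ≤ᵇ m ∸ 1
  palette-bad : Fin K₁ → Fin K₂ → Bool
  palette-bad i j = slot-free i ∧ not (palOK m p (pal' pal (H₁ i) (H₂ j) v))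
  degree-part : sumF (λ i → count {K₂} (λ _ → degree-bad i)) * m ^ 30 ≤ K₁ * K₂
  degree-part = begin
    sumF (λ i → count {K₂} (λ _ → degree-bad i)) * m ^ 30  ≡⟨ cong (_* m ^ 30) (sumF-count-const K₂ degree-bad) ⟩
    count degree-bad * K₂ * m ^ 30                          ≡⟨ *-assoc (count degree-bad) K₂ (m ^ 30) ⟩
    count degree-bad * (K₂ * m ^ 30)                        ≡⟨ cong (count degree-bad *_) (*-comm K₂ (m ^ 30)) ⟩
    count degree-bad * (m ^ 30 * K₂)                        ≡⟨ *-assoc (count degree-bad) (m ^ 30) K₂ ⟨
    count degree-bad * m ^ 30 * K₂
      ≤⟨ *-monoˡ-≤ K₂ (degree-count-bound m adj v H₁ indep₁ c≤n 33≤c m≥2 γ2¹⁶≤m no-loop d≤) ⟩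
    K₁ * K₂                                                  ∎
    where
    γ2¹⁶≤m = ≤-trans (*-monoʳ-≤ (momentConstant 16) (^-monoʳ-≤ 2 (m≤m+n 16 32))) γ2⁴⁸≤m
  palette-row : ∀ i → count (palette-bad i) * m ^ 30 ≤ K₂
  palette-row i = row (slot-free i) refl
    where
    c≤n² : _ ≤ n ^ 2
    c≤n² = ≤-trans c≤n (≤-trans (m≤m*n n n {{>-nonZero (≤-trans (s≤s z≤n) (≤-trans 33≤c c≤n))}})
                                (≤-reflexive (cong (n *_) (sym (*-identityʳ n)))))
    row : ∀ b → slot-free i ≡ b → count (λ j → b ∧ not (palOK m p (pal' pal (H₁ i) (H₂ j) v))) * m ^ 30 ≤ K₂
    row false _    = ≤-trans (≤-reflexive (cong (_* m ^ 30) (count-false K₂))) z≤n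
    row true  free = palette-count-bound m pal v (H₁ i) H₂ indep₂ c≤n² 33≤c m≥2 γ2⁴⁸≤m m¹⁰<p
                       (≤ᵇ⇒≤ (ℕ.suc (toℕ (H₁ i v))) (m ∸ 1) (subst T (sym free) _))

summands≤ : ∀ a b c m → a + b + c ≤ m → a ≤ m × b ≤ m × c ≤ m
summands≤ a b c m a+b+c≤m =
  ≤-trans (≤-trans (m≤m+n a b) (m≤m+n (a + b) c)) a+b+c≤m ,
  ≤-trans (≤-trans (m≤n+m b a) (m≤m+n (a + b) c)) a+b+c≤m ,
  ≤-trans (m≤n+m c (a + b)) a+b+c≤m

lemma3p7 : ∃[ c₀ ] ((c : ℕ) → c₀ ≤ c → ∃[ m₀ ] ((m : ℕ) → m₀ ≤ m →
    (n : ℕ) (inG : Fin n → Bool) (adj : Fin n → Fin n → Bool) → IsGraph n inG adj →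
    (pal : Fin n → Fin (n ^ 2) → Bool) →
    (∀ v → T (inG v) → m ^ 10 < palSize pal v) →
    (∀ v → T (inG v) → deg adj v ≤ m ^ 10 + m ^ 7) →
    (∀ v → T (inG v) → deg adj v < palSize pal v) →
    (K₁ : ℕ) (H₁ : Fin K₁ → Fin n → Fin m) →
    IsFamily K₁ n m H₁ → CWiseIndependent c K₁ n m H₁ →
    (K₂ : ℕ) (H₂ : Fin K₂ → Fin (n ^ 2) → Fin (m ∸ 1)) →
    IsFamily K₂ (n ^ 2) (m ∸ 1) H₂ → CWiseIndependent c K₂ (n ^ 2) (m ∸ 1) H₂ →
    (v : Fin n) → T (inG v) →
    countBad adj pal H₁ H₂ v * m ^ 30 ≤ 2 * (K₁ * K₂)))
-- m₀ makes m ≥ momentConstant 16 · 2⁴⁸, m ≥ c (hence c ≤ n) and m ≥ 2.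
lemma3p7 = 33 , λ c 33≤c → momentConstant 16 * 2 ^ 48 + c + 2 ,
  λ m m₀≤m n inG adj graph pal m¹⁰<p d≤ _ K₁ H₁ _ indep₁ K₂ H₂ _ indep₂ v v∈G →
    let γ2⁴⁸≤m , c≤m , 2≤m = summands≤ (momentConstant 16 * 2 ^ 48) c 2 m m₀≤m
    in bad-count-bound m adj pal H₁ H₂ v indep₁ indep₂ 33≤c
         (≤-trans c≤m (m^10<p≤n^2⇒m≤n m n (palSize pal v) (m¹⁰<p v v∈G) (count≤ (pal v))))
         2≤m γ2⁴⁸≤m (proj₁ (proj₂ graph) v) (m¹⁰<p v v∈G) (d≤ v v∈G)
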